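{- For positive integers $n$, \[\log_2\big(G(n,1)\big)=\sum_{i=1}^n c_{n,i}=\Big(\sum_{i=1}^n\sigma_0(i)\Big)-\mathrm{val}_2(n!)-n.\]
   Context: $\sigma_0(i)$ is the number of divisors of $i$ and $\mathrm{val}_2$ the $2$-adic valuation. For a partition $\lambda\vdash n$ let $m_\lambda(i)$ be the number of parts equal to $i$, let $h_\lambda(x)=\prod_{i\geq 1}(1+x^i)^{\lfloor n/i\rfloor-m_\lambda(i)}$, and let $G(n,x)=\gcd\{h_\lambda(x)\mid\lambda\vdash n\}$ (monic gcd in $\mathbb{Z}[x]$). The polynomial $G(n,x)$ can be written uniquely as $\prod_{i=1}^n(1+x^i)^{c_{n,i}}$ with nonnegative integers $c_{n,i}$; these are the $c_{n,i}$ in the statement. -}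

module Defs where

open import Data.Nat as ℕ using (ℕ; zero; suc; _≤_; _<_; _≥_; _/_; _∸_; _!; _≟_)
open import Data.Nat.Divisibility using (_∣?_)
open import Data.Integer as ℤ using (ℤ; +_)
open import Data.List using (List; []; _∷_; map; length; filter; replicate; _++_; upTo)
open import Data.Nat.ListAction using (sum)
open import Data.List.Relation.Unary.All using (All)
open import Data.List.Relation.Unary.Linked using (Linked)
open import Data.Product using (Σ; ∃; _×_)
open import Relation.Nullary using (¬_)
open import Relation.Binary.PropositionalEquality using (_≡_)

-- Polynomials in ℤ[x], as coefficient lists (constant term first).

Poly : Set
Poly = List ℤ

coeff : Poly → ℕ → ℤ
coeff []       _       = + 0
coeff (a ∷ _)  zero    = a
coeff (_ ∷ p)  (suc k) = coeff p k

-- equality of polynomials (ignores trailing zero coefficients)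
_≈ₚ_ : Poly → Poly → Set
p ≈ₚ q = ∀ k → coeff p k ≡ coeff q k

infixl 6 _+ₚ_
_+ₚ_ : Poly → Poly → Poly
[]      +ₚ q       = q
(a ∷ p) +ₚ []      = a ∷ p
(a ∷ p) +ₚ (b ∷ q) = (a ℤ.+ b) ∷ (p +ₚ q)

infixl 7 _*ₚ_
_*ₚ_ : Poly → Poly → Poly
[]      *ₚ q = []
(a ∷ p) *ₚ q = map (a ℤ.*_) q +ₚ (+ 0 ∷ (p *ₚ q))

oneₚ : Poly
oneₚ = + 1 ∷ []

_^ₚ_ : Poly → ℕ → Poly
p ^ₚ zero  = oneₚ
p ^ₚ suc k = p *ₚ (p ^ₚ k)

xpow : ℕ → Poly
xpow i = replicate i (+ 0) ++ (+ 1 ∷ [])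

onePlusXPow : ℕ → Poly
onePlusXPow i = oneₚ +ₚ xpow i

eval : Poly → ℤ → ℤ
eval []      x = + 0
eval (a ∷ p) x = a ℤ.+ x ℤ.* eval p x

_∣ₚ_ : Poly → Poly → Set
p ∣ₚ q = ∃ λ r → (p *ₚ r) ≈ₚ q

Monic : Poly → Set
Monic p = ∃ λ d → coeff p d ≡ + 1 × (∀ k → d < k → coeff p k ≡ + 0)

prodFrom1 : ℕ → (ℕ → Poly) → Poly
prodFrom1 zero    f = oneₚ
prodFrom1 (suc n) f = prodFrom1 n f *ₚ f (suc n)

prodOnePlus : ℕ → (ℕ → ℕ) → Poly
prodOnePlus n c = prodFrom1 n (λ i → onePlusXPow i ^ₚ c i)

IsPartition : ℕ → List ℕ → Set
IsPartition n λ′ = All (1 ≤_) λ′ × Linked _≥_ λ′ × sum λ′ ≡ n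

mult : List ℕ → ℕ → ℕ
mult λ′ i = length (filter (_≟ i) λ′)

hPoly : ℕ → List ℕ → Poly
hPoly n λ′ = prodFrom1 n (λ i → onePlusXPow i ^ₚ (hExp i))
  where
  hExp : ℕ → ℕ
  hExp zero    = 0
  hExp (suc j) = (n / suc j) ∸ mult λ′ (suc j)

IsMonicGcdH : ℕ → Poly → Set
IsMonicGcdH n g =
  Monic g ×
  (∀ λ′ → IsPartition n λ′ → g ∣ₚ hPoly n λ′) ×
  (∀ q → (∀ λ′ → IsPartition n λ′ → q ∣ₚ hPoly n λ′) → q ∣ₚ g)

sumFrom1 : ℕ → (ℕ → ℕ) → ℕ
sumFrom1 zero    f = 0
sumFrom1 (suc n) f = sumFrom1 n f ℕ.+ f (suc n)

σ₀ : ℕ → ℕ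
σ₀ i = length (filter (λ d → d ∣? i) (map suc (upTo i)))

-- 2-adic valuation (with fuel; fuel m suffices for argument m; val₂ 0 = 0 by convention)
val₂-aux : ℕ → ℕ → ℕ
val₂-aux zero     m = 0
val₂-aux (suc f) zero = 0
val₂-aux (suc f) (suc m) with 2 ∣? suc m
... | Relation.Nullary.yes _ = suc (val₂-aux f (suc m / 2))
... | Relation.Nullary.no  _ = 0

val₂ : ℕ → ℕ
val₂ m = val₂-aux m m

module Submission where

-- Over ℚ, 1 + x^i is the product of the cyclotomic polynomials Φ_k with k ∣ 2i and k ∤ i, and
-- distinct Φ_k are coprime, so the gcd of the h_λ is computed one Φ_k at a time. Only k = 2e
-- occurs, with multiplicity Σ_i (⌊n/i⌋ − m_λ(i)) [i/e odd] in h_λ; at most ⌊n/e⌋ parts of λ are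
-- odd multiples of e, with equality for λ = e^⌊n/e⌋ 1^(n mod e). Since every j ≤ n is i·2^s for
-- exactly one odd multiple i of e when e ∣ j, ⌊n/e⌋ = Σ_i [i/e odd] #{i, 2i, 4i, … ≤ n}, so
-- G = ∏_i (1 + x^i)^(⌊n/i⌋ − #{i, 2i, 4i, … ≤ n}) has exactly the minimal multiplicities. All the
-- polynomials involved have constant term ±1, which lets divisibility over ℚ descend to ℤ[x].
-- Finally G(1) = 2^(Σ c_i), Σ_i #{i, 2i, 4i, … ≤ n} = Σ_j (1 + val₂ j) = n + val₂(n!) and
-- Σ_i ⌊n/i⌋ = Σ_i σ₀(i).

open import Defs
open import Algebra.Bundles using (CommutativeRing)
open import Data.Empty using (⊥-elim)
open import Data.Integer as ℤ using (ℤ; +_; -[1+_])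
open import Data.Integer using () renaming (_+_ to _+ℤ_; _*_ to _*ℤ_; -_ to -ℤ_)
import Data.Integer.Properties as ℤP
import Data.Integer.Tactic.RingSolver as ℤ-Solver
open import Data.List using (List; []; _∷_; map; drop; filter; length; replicate; _++_; upTo)
import Data.List.Properties as ListP
open import Data.List.Relation.Unary.All using (All; []; _∷_)
import Data.List.Relation.Unary.All.Properties as AllP
open import Data.List.Relation.Unary.Linked using (Linked; []; [-]; _∷_)
open import Data.Maybe using (Maybe; just; nothing)
open import Data.Nat as ℕ using (ℕ; zero; suc; _+_; _*_; _∸_; _^_; _≤_; _≥_; _<_; z≤n; s≤s; _/_; _%_; _!; ⌊_/2⌋; parity)
import Data.Nat.Properties as ℕP
open import Data.Nat.Coprimality using (Coprime; coprime-divisor)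
open import Data.Nat.DivMod
  using (m/n<m; m≡m%n+[m/n]*n; m%n<n; m*n/n≡m; m<n⇒m/n≡0; +-distrib-/; m<n⇒m%n≡m; m*n%n≡0; [m+kn]%n≡m%n; n%1≡0; /-monoˡ-≤)
open import Data.Nat.Divisibility
  using (_∣_; _∣?_; divides; ∣-trans; ∣-refl; ∣-antisym; ∣⇒≤; 0∣⇒≡0; ∣1⇒≡1; ∣m∣n⇒∣m+n; *-cancelˡ-∣; *-monoʳ-∣; n∣m⇒m%n≡0)
open import Data.Nat.GCD using (gcd; gcd-GCD; module Bézout; gcd[m,n]∣m; gcd[m,n]∣n; gcd[m,n]≢0)
open import Data.Nat.Induction using (<-rec)
open import Data.Nat.ListAction using (sum)
open import Data.Nat.ListAction.Properties using (sum-++)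
import Data.Nat.Tactic.RingSolver as ℕ-Solver
open import Data.Parity using (0ℙ; 1ℙ)
open import Data.Product using (Σ; ∃; _×_; _,_; proj₁; proj₂)
open import Data.Sum using (_⊎_; inj₁; inj₂)
open import Level using (0ℓ)
open import Relation.Binary.Definitions using (tri<; tri≈; tri>)
open import Relation.Binary.PropositionalEquality hiding ([_])
import Relation.Binary.Reasoning.Setoid
open import Relation.Nullary using (¬_; Dec; yes; no)
open import Tactic.RingSolver using (solve-∀)
open import Tactic.RingSolver.Core.AlmostCommutativeRing using (AlmostCommutativeRing; fromCommutativeRing)


-- The ring ℤ[x]

-- A record rather than Defs' _≈ₚ_, so that both polynomials can be inferred from a proof.
infix 4 _≈_
record _≈_ (p q : Poly) : Set where
  constructor mk≈
  field at : ∀ k → coeff p k ≡ coeff q k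
open _≈_ public

≈-refl : ∀ {p} → p ≈ p
≈-refl = mk≈ λ _ → refl

≈-sym : ∀ {p q} → p ≈ q → q ≈ p
≈-sym e = mk≈ λ k → sym (at e k)

≈-trans : ∀ {p q r} → p ≈ q → q ≈ r → p ≈ r
≈-trans e f = mk≈ λ k → trans (at e k) (at f k)

≡⇒≈ : ∀ {p q} → p ≡ q → p ≈ q
≡⇒≈ refl = ≈-refl

∷-cong : ∀ {a b p q} → a ≡ b → p ≈ q → a ∷ p ≈ b ∷ q
∷-cong a≡b p≈q = mk≈ λ { zero → a≡b ; (suc k) → at p≈q k }

∷-tail : ∀ {a b p q} → a ∷ p ≈ b ∷ q → p ≈ q
∷-tail e = mk≈ λ k → at e (suc k)

scale : ℤ → Poly → Poly
scale a = map (a *ℤ_)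

negₚ : Poly → Poly
negₚ = map -ℤ_

shift : Poly → Poly
shift p = + 0 ∷ p

coeff-+ₚ : ∀ p q k → coeff (p +ₚ q) k ≡ coeff p k +ℤ coeff q k
coeff-+ₚ []      q       k       = sym (ℤP.+-identityˡ _)
coeff-+ₚ (a ∷ p) []      k       = sym (ℤP.+-identityʳ _)
coeff-+ₚ (a ∷ p) (b ∷ q) zero    = refl
coeff-+ₚ (a ∷ p) (b ∷ q) (suc k) = coeff-+ₚ p q k

coeff-map : ∀ (f : ℤ → ℤ) → f (+ 0) ≡ + 0 → ∀ p k → coeff (map f p) k ≡ f (coeff p k)
coeff-map f f0 []      k       = sym f0
coeff-map f f0 (a ∷ p) zero    = refl
coeff-map f f0 (a ∷ p) (suc k) = coeff-map f f0 p k

coeff-scale : ∀ a p k → coeff (scale a p) k ≡ a *ℤ coeff p k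
coeff-scale a = coeff-map (a *ℤ_) (ℤP.*-zeroʳ a)

coeff-negₚ : ∀ p k → coeff (negₚ p) k ≡ -ℤ coeff p k
coeff-negₚ = coeff-map -ℤ_ refl

+ₚ-cong : ∀ {p p′ q q′} → p ≈ p′ → q ≈ q′ → p +ₚ q ≈ p′ +ₚ q′
+ₚ-cong {p} {p′} {q} {q′} e f = mk≈ λ k → begin
  coeff (p +ₚ q) k          ≡⟨ coeff-+ₚ p q k ⟩
  coeff p k +ℤ coeff q k    ≡⟨ cong₂ _+ℤ_ (at e k) (at f k) ⟩
  coeff p′ k +ℤ coeff q′ k  ≡⟨ coeff-+ₚ p′ q′ k ⟨
  coeff (p′ +ₚ q′) k        ∎
  where open ≡-Reasoning

+ₚ-comm : ∀ p q → p +ₚ q ≈ q +ₚ p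
+ₚ-comm p q = mk≈ λ k → begin
  coeff (p +ₚ q) k        ≡⟨ coeff-+ₚ p q k ⟩
  coeff p k +ℤ coeff q k  ≡⟨ ℤP.+-comm (coeff p k) _ ⟩
  coeff q k +ℤ coeff p k  ≡⟨ coeff-+ₚ q p k ⟨
  coeff (q +ₚ p) k        ∎
  where open ≡-Reasoning

+ₚ-assoc : ∀ p q r → (p +ₚ q) +ₚ r ≈ p +ₚ (q +ₚ r)
+ₚ-assoc p q r = mk≈ λ k → begin
  coeff ((p +ₚ q) +ₚ r) k                    ≡⟨ coeff-+ₚ (p +ₚ q) r k ⟩
  coeff (p +ₚ q) k +ℤ coeff r k              ≡⟨ cong (_+ℤ coeff r k) (coeff-+ₚ p q k) ⟩
  (coeff p k +ℤ coeff q k) +ℤ coeff r k      ≡⟨ ℤP.+-assoc (coeff p k) _ _ ⟩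
  coeff p k +ℤ (coeff q k +ℤ coeff r k)      ≡⟨ cong (coeff p k +ℤ_) (coeff-+ₚ q r k) ⟨
  coeff p k +ℤ coeff (q +ₚ r) k              ≡⟨ coeff-+ₚ p (q +ₚ r) k ⟨
  coeff (p +ₚ (q +ₚ r)) k                    ∎
  where open ≡-Reasoning

+ₚ-identityˡ : ∀ p → [] +ₚ p ≈ p
+ₚ-identityˡ p = ≈-refl

+ₚ-identityʳ : ∀ p → p +ₚ [] ≈ p
+ₚ-identityʳ p = mk≈ λ k → trans (coeff-+ₚ p [] k) (ℤP.+-identityʳ _)

+ₚ-inverseˡ : ∀ p → negₚ p +ₚ p ≈ []
+ₚ-inverseˡ p = mk≈ λ k → begin
  coeff (negₚ p +ₚ p) k              ≡⟨ coeff-+ₚ (negₚ p) p k ⟩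
  coeff (negₚ p) k +ℤ coeff p k      ≡⟨ cong (_+ℤ coeff p k) (coeff-negₚ p k) ⟩
  -ℤ coeff p k +ℤ coeff p k          ≡⟨ ℤP.+-inverseˡ (coeff p k) ⟩
  + 0                                ∎
  where open ≡-Reasoning

+ₚ-inverseʳ : ∀ p → p +ₚ negₚ p ≈ []
+ₚ-inverseʳ p = ≈-trans (+ₚ-comm p (negₚ p)) (+ₚ-inverseˡ p)

negₚ-cong : ∀ {p q} → p ≈ q → negₚ p ≈ negₚ q
negₚ-cong {p} {q} e = mk≈ λ k →
  trans (coeff-negₚ p k) (trans (cong -ℤ_ (at e k)) (sym (coeff-negₚ q k)))

scale-cong : ∀ a {p q} → p ≈ q → scale a p ≈ scale a q
scale-cong a {p} {q} e = mk≈ λ k →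
  trans (coeff-scale a p k) (trans (cong (a *ℤ_) (at e k)) (sym (coeff-scale a q k)))

scale-congˡ : ∀ {a b} p → a ≡ b → scale a p ≈ scale b p
scale-congˡ p refl = ≈-refl

scale-distribˡ : ∀ a p q → scale a (p +ₚ q) ≈ scale a p +ₚ scale a q
scale-distribˡ a p q = mk≈ λ k → begin
  coeff (scale a (p +ₚ q)) k                  ≡⟨ coeff-scale a (p +ₚ q) k ⟩
  a *ℤ coeff (p +ₚ q) k                       ≡⟨ cong (a *ℤ_) (coeff-+ₚ p q k) ⟩
  a *ℤ (coeff p k +ℤ coeff q k)               ≡⟨ ℤP.*-distribˡ-+ a (coeff p k) _ ⟩
  a *ℤ coeff p k +ℤ a *ℤ coeff q k            ≡⟨ cong₂ _+ℤ_ (coeff-scale a p k) (coeff-scale a q k) ⟨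
  coeff (scale a p) k +ℤ coeff (scale a q) k  ≡⟨ coeff-+ₚ (scale a p) (scale a q) k ⟨
  coeff (scale a p +ₚ scale a q) k            ∎
  where open ≡-Reasoning

scale-distribʳ : ∀ a b p → scale (a +ℤ b) p ≈ scale a p +ₚ scale b p
scale-distribʳ a b p = mk≈ λ k → begin
  coeff (scale (a +ℤ b) p) k                  ≡⟨ coeff-scale (a +ℤ b) p k ⟩
  (a +ℤ b) *ℤ coeff p k                       ≡⟨ ℤP.*-distribʳ-+ (coeff p k) a b ⟩
  a *ℤ coeff p k +ℤ b *ℤ coeff p k            ≡⟨ cong₂ _+ℤ_ (coeff-scale a p k) (coeff-scale b p k) ⟨
  coeff (scale a p) k +ℤ coeff (scale b p) k  ≡⟨ coeff-+ₚ (scale a p) (scale b p) k ⟨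
  coeff (scale a p +ₚ scale b p) k            ∎
  where open ≡-Reasoning

scale-zero : ∀ p → scale (+ 0) p ≈ []
scale-zero p = mk≈ (coeff-scale (+ 0) p)

scale-identity : ∀ p → scale (+ 1) p ≈ p
scale-identity p = mk≈ λ k → trans (coeff-scale (+ 1) p k) (ℤP.*-identityˡ _)

scale-scale : ∀ a b p → scale a (scale b p) ≈ scale (a *ℤ b) p
scale-scale a b p = mk≈ λ k → begin
  coeff (scale a (scale b p)) k  ≡⟨ coeff-scale a (scale b p) k ⟩
  a *ℤ coeff (scale b p) k       ≡⟨ cong (a *ℤ_) (coeff-scale b p k) ⟩
  a *ℤ (b *ℤ coeff p k)          ≡⟨ ℤP.*-assoc a b _ ⟨
  (a *ℤ b) *ℤ coeff p k          ≡⟨ coeff-scale (a *ℤ b) p k ⟨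
  coeff (scale (a *ℤ b) p) k     ∎
  where open ≡-Reasoning

scale-comm : ∀ a b p → scale a (scale b p) ≈ scale b (scale a p)
scale-comm a b p = ≈-trans (scale-scale a b p)
  (≈-trans (scale-congˡ p (ℤP.*-comm a b)) (≈-sym (scale-scale b a p)))

scale-shift : ∀ a p → scale a (shift p) ≈ shift (scale a p)
scale-shift a p = ∷-cong (ℤP.*-zeroʳ a) ≈-refl

shift-[] : shift [] ≈ []
shift-[] = mk≈ λ { zero → refl ; (suc k) → refl }

+ₚ-leftComm : ∀ a b c → a +ₚ (b +ₚ c) ≈ b +ₚ (a +ₚ c)
+ₚ-leftComm a b c = ≈-trans (≈-sym (+ₚ-assoc a b c)) (≈-trans (+ₚ-cong (+ₚ-comm a b) ≈-refl) (+ₚ-assoc b a c))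

+ₚ-interchange : ∀ a b c d → (a +ₚ b) +ₚ (c +ₚ d) ≈ (a +ₚ c) +ₚ (b +ₚ d)
+ₚ-interchange a b c d = ≈-trans (+ₚ-assoc a b (c +ₚ d))
  (≈-trans (+ₚ-cong (≈-refl {a}) (+ₚ-leftComm b c d)) (≈-sym (+ₚ-assoc a c (b +ₚ d))))

*ₚ-zeroˡ : ∀ {p} → p ≈ [] → ∀ q → p *ₚ q ≈ []
*ₚ-zeroˡ {[]}    e q = ≈-refl
*ₚ-zeroˡ {a ∷ p} e q = ≈-trans
  (+ₚ-cong (≈-trans (scale-congˡ q (at e zero)) (scale-zero q)) (∷-cong refl (*ₚ-zeroˡ (mk≈ {p} (λ k → at e (suc k))) q)))
  shift-[]

*ₚ-zeroʳ : ∀ p → p *ₚ [] ≈ []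
*ₚ-zeroʳ []      = ≈-refl
*ₚ-zeroʳ (a ∷ p) = ≈-trans (∷-cong refl (*ₚ-zeroʳ p)) shift-[]

*ₚ-congˡ : ∀ {p p′} → p ≈ p′ → ∀ q → p *ₚ q ≈ p′ *ₚ q
*ₚ-congˡ {[]}    {p′}     e q = ≈-sym (*ₚ-zeroˡ (≈-sym e) q)
*ₚ-congˡ {a ∷ p} {[]}     e q = *ₚ-zeroˡ e q
*ₚ-congˡ {a ∷ p} {b ∷ p′} e q = +ₚ-cong (scale-congˡ q (at e zero)) (∷-cong refl (*ₚ-congˡ (∷-tail e) q))

*ₚ-congʳ : ∀ p {q q′} → q ≈ q′ → p *ₚ q ≈ p *ₚ q′
*ₚ-congʳ []      e = ≈-refl
*ₚ-congʳ (a ∷ p) e = +ₚ-cong (scale-cong a e) (∷-cong refl (*ₚ-congʳ p e))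

*ₚ-cong : ∀ {p p′ q q′} → p ≈ p′ → q ≈ q′ → p *ₚ q ≈ p′ *ₚ q′
*ₚ-cong {p} {p′} {q} e f = ≈-trans (*ₚ-congˡ e q) (*ₚ-congʳ p′ f)

*ₚ-distribˡ : ∀ p q r → p *ₚ (q +ₚ r) ≈ p *ₚ q +ₚ p *ₚ r
*ₚ-distribˡ []      q r = ≈-refl
*ₚ-distribˡ (a ∷ p) q r = ≈-trans
  (+ₚ-cong (scale-distribˡ a q r) (∷-cong refl (*ₚ-distribˡ p q r)))
  (+ₚ-interchange (scale a q) (scale a r) (shift (p *ₚ q)) (shift (p *ₚ r)))

*ₚ-distribʳ : ∀ r p q → (p +ₚ q) *ₚ r ≈ p *ₚ r +ₚ q *ₚ r
*ₚ-distribʳ r []      q       = ≈-refl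
*ₚ-distribʳ r (a ∷ p) []      = ≈-sym (+ₚ-identityʳ _)
*ₚ-distribʳ r (a ∷ p) (b ∷ q) = ≈-trans
  (+ₚ-cong (scale-distribʳ a b r) (∷-cong refl (*ₚ-distribʳ r p q)))
  (+ₚ-interchange (scale a r) (scale b r) (shift (p *ₚ r)) (shift (q *ₚ r)))

scale-*ₚ : ∀ a p q → scale a p *ₚ q ≈ scale a (p *ₚ q)
scale-*ₚ a []      q = ≈-refl
scale-*ₚ a (b ∷ p) q = ≈-trans
  (+ₚ-cong (≈-sym (scale-scale a b q)) (∷-cong refl (scale-*ₚ a p q)))
  (≈-trans (+ₚ-cong ≈-refl (≈-sym (scale-shift a (p *ₚ q)))) (≈-sym (scale-distribˡ a (scale b q) (shift (p *ₚ q)))))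

*ₚ-scale : ∀ a p q → p *ₚ scale a q ≈ scale a (p *ₚ q)
*ₚ-scale a []      q = ≈-refl
*ₚ-scale a (b ∷ p) q = ≈-trans
  (+ₚ-cong (scale-comm b a q) (∷-cong refl (*ₚ-scale a p q)))
  (≈-trans (+ₚ-cong ≈-refl (≈-sym (scale-shift a (p *ₚ q)))) (≈-sym (scale-distribˡ a (scale b q) (shift (p *ₚ q)))))

shift-*ₚ : ∀ p q → shift p *ₚ q ≈ shift (p *ₚ q)
shift-*ₚ p q = +ₚ-cong (scale-zero q) ≈-refl

*ₚ-∷ : ∀ p b q → p *ₚ (b ∷ q) ≈ scale b p +ₚ shift (p *ₚ q)
*ₚ-∷ []      b q = ≈-sym shift-[]
*ₚ-∷ (a ∷ p) b q = ≈-trans (+ₚ-cong (≈-refl {scale a (b ∷ q)}) (∷-cong refl (*ₚ-∷ p b q)))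
  (∷-cong (cong (_+ℤ + 0) (ℤP.*-comm a b)) (+ₚ-leftComm (scale a q) (scale b p) (shift (p *ₚ q))))

*ₚ-comm : ∀ p q → p *ₚ q ≈ q *ₚ p
*ₚ-comm []      q = ≈-sym (*ₚ-zeroʳ q)
*ₚ-comm (a ∷ p) q = ≈-trans (+ₚ-cong ≈-refl (∷-cong refl (*ₚ-comm p q))) (≈-sym (*ₚ-∷ q a p))

*ₚ-assoc : ∀ p q r → (p *ₚ q) *ₚ r ≈ p *ₚ (q *ₚ r)
*ₚ-assoc []      q r = ≈-refl
*ₚ-assoc (a ∷ p) q r = ≈-trans (*ₚ-distribʳ r (scale a q) (shift (p *ₚ q)))
  (+ₚ-cong (scale-*ₚ a q r) (≈-trans (shift-*ₚ (p *ₚ q) r) (∷-cong refl (*ₚ-assoc p q r))))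

*ₚ-identityˡ : ∀ p → oneₚ *ₚ p ≈ p
*ₚ-identityˡ p = ≈-trans (+ₚ-cong (scale-identity p) shift-[]) (+ₚ-identityʳ p)

*ₚ-identityʳ : ∀ p → p *ₚ oneₚ ≈ p
*ₚ-identityʳ p = ≈-trans (*ₚ-comm p oneₚ) (*ₚ-identityˡ p)

ℤ[x] : CommutativeRing 0ℓ 0ℓ
ℤ[x] = record
  { Carrier = Poly
  ; _≈_ = _≈_
  ; _+_ = _+ₚ_
  ; _*_ = _*ₚ_
  ; -_ = negₚ
  ; 0# = []
  ; 1# = oneₚ
  ; isCommutativeRing = record
    { isRing = record
      { +-isAbelianGroup = record
        { isGroup = record
          { isMonoid = record
            { isSemigroup = record
              { isMagma = record
                { isEquivalence = record { refl = ≈-refl ; sym = ≈-sym ; trans = ≈-trans }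
                ; ∙-cong = +ₚ-cong }
              ; assoc = +ₚ-assoc }
            ; identity = +ₚ-identityˡ , +ₚ-identityʳ }
          ; inverse = +ₚ-inverseˡ , +ₚ-inverseʳ
          ; ⁻¹-cong = negₚ-cong }
        ; comm = +ₚ-comm }
      ; *-cong = *ₚ-cong
      ; *-assoc = *ₚ-assoc
      ; *-identity = *ₚ-identityˡ , *ₚ-identityʳ
      ; distrib = *ₚ-distribˡ , *ₚ-distribʳ }
    ; *-comm = *ₚ-comm }
  }

[]≈? : ∀ p → Maybe ([] ≈ p)
[]≈? []      = just ≈-refl
[]≈? (a ∷ p) with a ℤ.≟ + 0 | []≈? p
... | yes a≡0 | just []≈p = just (mk≈ λ { zero → sym a≡0 ; (suc k) → at []≈p k })
... | _       | _         = nothing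

ℤ[x]-solverRing : AlmostCommutativeRing 0ℓ 0ℓ
ℤ[x]-solverRing = fromCommutativeRing ℤ[x] []≈?

module ℤ[x]-Reasoning = Relation.Binary.Reasoning.Setoid (CommutativeRing.setoid ℤ[x])

-- Units, divisibility and coprimality over ℚ

infixl 6 _-ₚ_
_-ₚ_ : Poly → Poly → Poly
p -ₚ q = p +ₚ negₚ q

const : ℤ → Poly
const a = a ∷ []

const-*ₚ : ∀ a p → const a *ₚ p ≈ scale a p
const-*ₚ a p = ≈-trans (+ₚ-cong ≈-refl shift-[]) (+ₚ-identityʳ _)

const-*ₚ-const : ∀ a b → const a *ₚ const b ≈ const (a *ℤ b)
const-*ₚ-const a b = ≈-trans (const-*ₚ a (const b)) (mk≈ λ { zero → refl ; (suc k) → refl })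

const-*ₚ-cancel : ∀ N .{{_ : ℤ.NonZero N}} {A B} → const N *ₚ A ≈ const N *ₚ B → A ≈ B
const-*ₚ-cancel N {A} {B} e = mk≈ λ k → ℤP.*-cancelˡ-≡ N (coeff A k) (coeff B k) (begin
  N *ℤ coeff A k               ≡⟨ coeff-scale N A k ⟨
  coeff (scale N A) k          ≡⟨ at (≈-trans (≈-sym (const-*ₚ N A)) (≈-trans e (const-*ₚ N B))) k ⟩
  coeff (scale N B) k          ≡⟨ coeff-scale N B k ⟩
  N *ℤ coeff B k               ∎)
  where open ≡-Reasoning

coeff₀-*ₚ : ∀ p q → coeff (p *ₚ q) 0 ≡ coeff p 0 *ℤ coeff q 0
coeff₀-*ₚ []      q = refl
coeff₀-*ₚ (a ∷ p) q = trans (coeff-+ₚ (scale a q) (shift (p *ₚ q)) 0) (trans (ℤP.+-identityʳ _) (coeff-scale a q 0))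

IsUnit : ℤ → Set
IsUnit u = u ≡ + 1 ⊎ u ≡ -[1+ 0 ]

isUnit-* : ∀ {a b} → IsUnit a → IsUnit b → IsUnit (a *ℤ b)
isUnit-* (inj₁ refl) (inj₁ refl) = inj₁ refl
isUnit-* (inj₁ refl) (inj₂ refl) = inj₂ refl
isUnit-* (inj₂ refl) (inj₁ refl) = inj₂ refl
isUnit-* (inj₂ refl) (inj₂ refl) = inj₁ refl

isUnit-*⁻ˡ : ∀ a b → IsUnit (a *ℤ b) → IsUnit a
isUnit-*⁻ˡ a b u with ℕP.m*n≡1⇒m≡1 ℤ.∣ a ∣ ℤ.∣ b ∣ (trans (sym (ℤP.abs-* a b)) (∣unit∣ u))
  where
  ∣unit∣ : ∀ {u} → IsUnit u → ℤ.∣ u ∣ ≡ 1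
  ∣unit∣ (inj₁ refl) = refl
  ∣unit∣ (inj₂ refl) = refl
isUnit-*⁻ˡ (+ .1)     b u | refl = inj₁ refl
isUnit-*⁻ˡ -[1+ .0 ]  b u | refl = inj₂ refl

isUnit-square : ∀ {u} → IsUnit u → u *ℤ u ≡ + 1
isUnit-square (inj₁ refl) = refl
isUnit-square (inj₂ refl) = refl

-- Polynomials with constant term ±1 are units of ℤ[[x]]; this is what lets them cancel and divide
-- like monic polynomials below.
record UnitConst (p : Poly) : Set where
  constructor mkUnitConst
  field isUnit : IsUnit (coeff p 0)
open UnitConst public

unitConst-*ₚ : ∀ {p q} → UnitConst p → UnitConst q → UnitConst (p *ₚ q)
unitConst-*ₚ {p} {q} (mkUnitConst u) (mkUnitConst v) = mkUnitConst (subst IsUnit (sym (coeff₀-*ₚ p q)) (isUnit-* u v))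

unitConst-≈ : ∀ {p q} → p ≈ q → UnitConst p → UnitConst q
unitConst-≈ e (mkUnitConst u) = mkUnitConst (subst IsUnit (at e 0) u)

unitConst-*ₚ⁻ˡ : ∀ {p q r} → p *ₚ q ≈ r → UnitConst r → UnitConst p
unitConst-*ₚ⁻ˡ {p} {q} e (mkUnitConst u) =
  mkUnitConst (isUnit-*⁻ˡ (coeff p 0) (coeff q 0) (subst IsUnit (trans (sym (at e 0)) (coeff₀-*ₚ p q)) u))

infix 4 _∣ₓ_
record _∣ₓ_ (p q : Poly) : Set where
  constructor mk∣ₓ
  field
    quotient : Poly
    equation : p *ₚ quotient ≈ q
open _∣ₓ_ public

∣ₓ⇒∣ₚ : ∀ {p q} → p ∣ₓ q → p ∣ₚ q
∣ₓ⇒∣ₚ (mk∣ₓ r e) = r , at e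

∣ₚ⇒∣ₓ : ∀ {p q} → p ∣ₚ q → p ∣ₓ q
∣ₚ⇒∣ₓ (r , e) = mk∣ₓ r (mk≈ e)

∣ₓ-refl : ∀ p → p ∣ₓ p
∣ₓ-refl p = mk∣ₓ oneₚ (*ₚ-identityʳ p)

∣ₓ-respʳ-≈ : ∀ {p q q′} → p ∣ₓ q → q ≈ q′ → p ∣ₓ q′
∣ₓ-respʳ-≈ (mk∣ₓ r e) f = mk∣ₓ r (≈-trans e f)

∣ₓ-respˡ-≈ : ∀ {p p′ q} → p ≈ p′ → p ∣ₓ q → p′ ∣ₓ q
∣ₓ-respˡ-≈ e (mk∣ₓ r f) = mk∣ₓ r (≈-trans (*ₚ-congˡ (≈-sym e) r) f)

∣ₓ-trans : ∀ {p q r} → p ∣ₓ q → q ∣ₓ r → p ∣ₓ r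
∣ₓ-trans {p} (mk∣ₓ a e) (mk∣ₓ b f) = mk∣ₓ (a *ₚ b) (≈-trans (≈-sym (*ₚ-assoc p a b)) (≈-trans (*ₚ-congˡ e b) f))

∣ₓ-*ˡ : ∀ {p q} r → p ∣ₓ q → p ∣ₓ r *ₚ q
∣ₓ-*ˡ {p} {q} r (mk∣ₓ a e) = mk∣ₓ (r *ₚ a) (≈-trans (leftComm p r a) (*ₚ-congʳ r e))
  where
  leftComm : ∀ p r a → p *ₚ (r *ₚ a) ≈ r *ₚ (p *ₚ a)
  leftComm = solve-∀ ℤ[x]-solverRing

*-∣ₓ-* : ∀ {p q r s} → p ∣ₓ q → r ∣ₓ s → p *ₚ r ∣ₓ q *ₚ s
*-∣ₓ-* {p} {q} {r} (mk∣ₓ a e) (mk∣ₓ b f) = mk∣ₓ (a *ₚ b) (≈-trans (interchange p r a b) (*ₚ-cong e f))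
  where
  interchange : ∀ p r a b → (p *ₚ r) *ₚ (a *ₚ b) ≈ (p *ₚ a) *ₚ (r *ₚ b)
  interchange = solve-∀ ℤ[x]-solverRing

∣ₓ-+ₚ : ∀ {p q r} → p ∣ₓ q → p ∣ₓ r → p ∣ₓ q +ₚ r
∣ₓ-+ₚ {p} (mk∣ₓ a e) (mk∣ₓ b f) = mk∣ₓ (a +ₚ b) (≈-trans (*ₚ-distribˡ p a b) (+ₚ-cong e f))

shift-const-∣ₓ : ∀ {N p} → const N ∣ₓ shift p → const N ∣ₓ p
shift-const-∣ₓ {N} {p} (mk∣ₓ s e) = mk∣ₓ (drop 1 s) (mk≈ λ k → begin
  coeff (const N *ₚ drop 1 s) k   ≡⟨ at (const-*ₚ N (drop 1 s)) k ⟩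
  coeff (scale N (drop 1 s)) k    ≡⟨ coeff-scale N (drop 1 s) k ⟩
  N *ℤ coeff (drop 1 s) k         ≡⟨ cong (N *ℤ_) (coeff-drop₁ s k) ⟩
  N *ℤ coeff s (suc k)            ≡⟨ coeff-scale N s (suc k) ⟨
  coeff (scale N s) (suc k)       ≡⟨ at (≈-trans (≈-sym (const-*ₚ N s)) e) (suc k) ⟩
  coeff p k                       ∎)
  where
  open ≡-Reasoning
  coeff-drop₁ : ∀ s k → coeff (drop 1 s) k ≡ coeff s (suc k)
  coeff-drop₁ []      k = refl
  coeff-drop₁ (a ∷ s) k = refl

-- Long division by the power series inverse of M, one coefficient at a time.
const-∣ₓ-*ₚ-unitConst : ∀ {M} → UnitConst M → ∀ N R → const N ∣ₓ R *ₚ M → const N ∣ₓ R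
const-∣ₓ-*ₚ-unitConst u N []      _          = mk∣ₓ [] (*ₚ-zeroʳ (const N))
const-∣ₓ-*ₚ-unitConst {M} u N (r ∷ R) (mk∣ₓ T e) =
  mk∣ₓ (s₀ ∷ S) (≈-trans (const-*ₚ N (s₀ ∷ S)) (∷-cong (sym r≡Ns₀) (≈-trans (≈-sym (const-*ₚ N S)) NS≈R)))
  where
  m₀ = coeff M 0
  t₀ = coeff T 0
  s₀ = t₀ *ℤ m₀
  r≡Ns₀ : r ≡ N *ℤ s₀
  r≡Ns₀ = begin
    r                    ≡⟨ ℤP.*-identityʳ r ⟨
    r *ℤ + 1             ≡⟨ cong (r *ℤ_) (isUnit-square (isUnit u)) ⟨
    r *ℤ (m₀ *ℤ m₀)      ≡⟨ ℤP.*-assoc r m₀ m₀ ⟨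
    (r *ℤ m₀) *ℤ m₀      ≡⟨ cong (_*ℤ m₀) r*m₀≡N*t₀ ⟩
    (N *ℤ t₀) *ℤ m₀      ≡⟨ ℤP.*-assoc N t₀ m₀ ⟩
    N *ℤ s₀              ∎
    where
    open ≡-Reasoning
    r*m₀≡N*t₀ : r *ℤ m₀ ≡ N *ℤ t₀
    r*m₀≡N*t₀ = trans (sym (coeff₀-*ₚ (r ∷ R) M)) (trans (sym (at e 0)) (coeff₀-*ₚ (const N) T))
  tail-divisible : const N ∣ₓ shift (R *ₚ M)
  tail-divisible = mk∣ₓ (T -ₚ const s₀ *ₚ M) (begin
    const N *ₚ (T -ₚ const s₀ *ₚ M)
      ≈⟨ distrib (const N) T (const s₀) M ⟩
    const N *ₚ T -ₚ (const N *ₚ const s₀) *ₚ M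
      ≈⟨ +ₚ-cong e (negₚ-cong (*ₚ-congˡ (const-*ₚ-const N s₀) M)) ⟩
    (scale r M +ₚ shift (R *ₚ M)) -ₚ const (N *ℤ s₀) *ₚ M
      ≈⟨ +ₚ-cong (+ₚ-cong (≈-sym (const-*ₚ r M)) ≈-refl) (negₚ-cong (*ₚ-congˡ (≡⇒≈ (cong const (sym r≡Ns₀))) M)) ⟩
    (const r *ₚ M +ₚ shift (R *ₚ M)) -ₚ const r *ₚ M
      ≈⟨ cancel (const r *ₚ M) (shift (R *ₚ M)) ⟩
    shift (R *ₚ M) ∎)
    where
    open ℤ[x]-Reasoning
    distrib : ∀ n t s m → n *ₚ (t -ₚ s *ₚ m) ≈ n *ₚ t -ₚ (n *ₚ s) *ₚ m
    distrib = solve-∀ ℤ[x]-solverRing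
    cancel : ∀ a b → (a +ₚ b) -ₚ a ≈ b
    cancel = solve-∀ ℤ[x]-solverRing
  IH = const-∣ₓ-*ₚ-unitConst u N R (shift-const-∣ₓ tail-divisible)
  S = quotient IH
  NS≈R : const N *ₚ S ≈ R
  NS≈R = equation IH

*ₚ-cancelˡ-unitConst : ∀ {M A B} → UnitConst M → M *ₚ A ≈ M *ₚ B → A ≈ B
*ₚ-cancelˡ-unitConst {M} {A} {B} u e = begin
  A                              ≈⟨ split A B ⟩
  (A -ₚ B) +ₚ B                  ≈⟨ +ₚ-cong A-B≈0 ≈-refl ⟩
  [] +ₚ B                        ≈⟨ ≈-refl ⟩
  B                              ∎
  where
  open ℤ[x]-Reasoning
  split : ∀ a b → a ≈ (a -ₚ b) +ₚ b
  split = solve-∀ ℤ[x]-solverRing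
  factor : ∀ m a b → (a -ₚ b) *ₚ m ≈ m *ₚ a -ₚ m *ₚ b
  factor = solve-∀ ℤ[x]-solverRing
  0∣[A-B]M : const (+ 0) ∣ₓ (A -ₚ B) *ₚ M
  0∣[A-B]M = mk∣ₓ [] (≈-sym (begin
    (A -ₚ B) *ₚ M          ≈⟨ factor M A B ⟩
    M *ₚ A -ₚ M *ₚ B       ≈⟨ +ₚ-cong e ≈-refl ⟩
    M *ₚ B -ₚ M *ₚ B       ≈⟨ +ₚ-inverseʳ (M *ₚ B) ⟩
    []                     ≈⟨ *ₚ-zeroʳ (const (+ 0)) ⟨
    const (+ 0) *ₚ []      ∎))
  A-B≈0 : A -ₚ B ≈ []
  A-B≈0 with const-∣ₓ-*ₚ-unitConst u (+ 0) (A -ₚ B) 0∣[A-B]M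
  ... | mk∣ₓ S eS = ≈-trans (≈-sym eS) (≈-trans (const-*ₚ (+ 0) S) (scale-zero S))

-- Divisibility in ℚ[x], with the denominator cleared.
infix 4 _∣ℚ_
record _∣ℚ_ (q F : Poly) : Set where
  constructor mk∣ℚ
  field
    denominator : ℤ
    nonZero     : ℤ.NonZero denominator
    scaled      : q ∣ₓ const denominator *ₚ F

∣ₓ⇒∣ℚ : ∀ {q F} → q ∣ₓ F → q ∣ℚ F
∣ₓ⇒∣ℚ {q} {F} q∣F = mk∣ℚ (+ 1) _ (∣ₓ-respʳ-≈ q∣F (≈-sym (≈-trans (const-*ₚ (+ 1) F) (scale-identity F))))

∣ℚ-respʳ-≈ : ∀ {q F F′} → q ∣ℚ F → F ≈ F′ → q ∣ℚ F′
∣ℚ-respʳ-≈ {q} {F} {F′} (mk∣ℚ N N≢0 q∣NF) e = mk∣ℚ N N≢0 (∣ₓ-respʳ-≈ q∣NF (*ₚ-congʳ (const N) e))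

∣ℚ⇒∣ₓ : ∀ {q F} → UnitConst q → q ∣ℚ F → q ∣ₓ F
∣ℚ⇒∣ₓ {q} {F} u (mk∣ℚ N N≢0 (mk∣ₓ R qR≈NF)) =
  mk∣ₓ S (const-*ₚ-cancel N {{N≢0}} (begin
    const N *ₚ (q *ₚ S)     ≈⟨ swap (const N) q S ⟩
    q *ₚ (const N *ₚ S)     ≈⟨ *ₚ-congʳ q NS≈R ⟩
    q *ₚ R                  ≈⟨ qR≈NF ⟩
    const N *ₚ F            ∎))
  where
  open ℤ[x]-Reasoning
  swap : ∀ n q s → n *ₚ (q *ₚ s) ≈ q *ₚ (n *ₚ s)
  swap = solve-∀ ℤ[x]-solverRing
  N∣R : const N ∣ₓ R
  N∣R = const-∣ₓ-*ₚ-unitConst u N R (mk∣ₓ F (≈-sym (≈-trans (*ₚ-comm R q) qR≈NF)))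
  S = quotient N∣R
  NS≈R = equation N∣R

-- Coprimality in ℚ[x]: a Bézout identity with the denominator cleared.
record Coprimeℚ (A B : Poly) : Set where
  constructor mkCoprimeℚ
  field
    s t     : Poly
    N       : ℤ
    nonZero : ℤ.NonZero N
    bezout  : s *ₚ A +ₚ t *ₚ B ≈ const N

coprimeℚ-sym : ∀ {A B} → Coprimeℚ A B → Coprimeℚ B A
coprimeℚ-sym {A} {B} (mkCoprimeℚ s t N N≢0 e) = mkCoprimeℚ t s N N≢0 (≈-trans (+ₚ-comm (t *ₚ B) (s *ₚ A)) e)

coprimeℚ-oneʳ : ∀ A → Coprimeℚ A oneₚ
coprimeℚ-oneʳ A = mkCoprimeℚ [] oneₚ (+ 1) _ (mk≈ λ { zero → refl ; (suc k) → refl })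

coprimeℚ-*ʳ : ∀ {A B C} → Coprimeℚ A B → Coprimeℚ A C → Coprimeℚ A (B *ₚ C)
coprimeℚ-*ʳ {A} {B} {C} (mkCoprimeℚ s t N N≢0 e) (mkCoprimeℚ u v M M≢0 f) =
  mkCoprimeℚ (s *ₚ u *ₚ A +ₚ s *ₚ v *ₚ C +ₚ t *ₚ B *ₚ u) (t *ₚ v) (N *ℤ M) (ℤP.i*j≢0 N M {{N≢0}} {{M≢0}})
    (≈-trans (expand A B C s t u v) (≈-trans (*ₚ-cong e f) (const-*ₚ-const N M)))
  where
  expand : ∀ A B C s t u v →
    (s *ₚ u *ₚ A +ₚ s *ₚ v *ₚ C +ₚ t *ₚ B *ₚ u) *ₚ A +ₚ (t *ₚ v) *ₚ (B *ₚ C) ≈ (s *ₚ A +ₚ t *ₚ B) *ₚ (u *ₚ A +ₚ v *ₚ C)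
  expand = solve-∀ ℤ[x]-solverRing

coprimeℚ-*ʳ⁻ : ∀ {A B C} → Coprimeℚ A (B *ₚ C) → Coprimeℚ A B
coprimeℚ-*ʳ⁻ {A} {B} {C} (mkCoprimeℚ s t N N≢0 e) = mkCoprimeℚ s (t *ₚ C) N N≢0 (≈-trans (+ₚ-cong ≈-refl (regroup t B C)) e)
  where
  regroup : ∀ t B C → (t *ₚ C) *ₚ B ≈ t *ₚ (B *ₚ C)
  regroup = solve-∀ ℤ[x]-solverRing

coprimeℚ-^ʳ : ∀ {A B} → Coprimeℚ A B → ∀ m → Coprimeℚ A (B ^ₚ m)
coprimeℚ-^ʳ c zero    = coprimeℚ-oneʳ _
coprimeℚ-^ʳ c (suc m) = coprimeℚ-*ʳ c (coprimeℚ-^ʳ c m)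

coprimeℚ-^ : ∀ {A B} → Coprimeℚ A B → ∀ m → Coprimeℚ (A ^ₚ m) (B ^ₚ m)
coprimeℚ-^ c m = coprimeℚ-sym (coprimeℚ-^ʳ (coprimeℚ-sym (coprimeℚ-^ʳ c m)) m)

coprimeℚ-*-∣ℚ : ∀ {A B F} → A ∣ₓ F → B ∣ₓ F → Coprimeℚ A B → A *ₚ B ∣ℚ F
coprimeℚ-*-∣ℚ {A} {B} {F} (mk∣ₓ x Ax≈F) (mk∣ₓ y By≈F) (mkCoprimeℚ s t N N≢0 e) =
  mk∣ℚ N N≢0 (mk∣ₓ (s *ₚ y +ₚ t *ₚ x) (begin
    (A *ₚ B) *ₚ (s *ₚ y +ₚ t *ₚ x)            ≈⟨ expand A B s t x y ⟩
    s *ₚ (A *ₚ (B *ₚ y)) +ₚ t *ₚ (B *ₚ (A *ₚ x)) ≈⟨ +ₚ-cong (*ₚ-congʳ s (*ₚ-congʳ A By≈F)) (*ₚ-congʳ t (*ₚ-congʳ B Ax≈F)) ⟩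
    s *ₚ (A *ₚ F) +ₚ t *ₚ (B *ₚ F)            ≈⟨ factor A B s t F ⟩
    (s *ₚ A +ₚ t *ₚ B) *ₚ F                   ≈⟨ *ₚ-congˡ e F ⟩
    const N *ₚ F                              ∎))
  where
  open ℤ[x]-Reasoning
  expand : ∀ A B s t x y → (A *ₚ B) *ₚ (s *ₚ y +ₚ t *ₚ x) ≈ s *ₚ (A *ₚ (B *ₚ y)) +ₚ t *ₚ (B *ₚ (A *ₚ x))
  expand = solve-∀ ℤ[x]-solverRing
  factor : ∀ A B s t F → s *ₚ (A *ₚ F) +ₚ t *ₚ (B *ₚ F) ≈ (s *ₚ A +ₚ t *ₚ B) *ₚ F
  factor = solve-∀ ℤ[x]-solverRing

∣ℚ-coprimeℚ-cofactors : ∀ {q H P T} → q ∣ℚ H *ₚ P → q ∣ℚ H *ₚ T → Coprimeℚ P T → q ∣ℚ H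
∣ℚ-coprimeℚ-cofactors {q} {H} {P} {T} (mk∣ℚ N₁ N₁≢0 (mk∣ₓ a qa≈N₁HP)) (mk∣ℚ N₂ N₂≢0 (mk∣ₓ b qb≈N₂HT)) (mkCoprimeℚ s t M M≢0 e) =
  mk∣ℚ (N₁ *ℤ N₂ *ℤ M) nonZero (mk∣ₓ (c₂ *ₚ s *ₚ a +ₚ c₁ *ₚ t *ₚ b) (begin
    q *ₚ (c₂ *ₚ s *ₚ a +ₚ c₁ *ₚ t *ₚ b)
      ≈⟨ expand q a b c₁ c₂ s t ⟩
    c₂ *ₚ s *ₚ (q *ₚ a) +ₚ c₁ *ₚ t *ₚ (q *ₚ b)
      ≈⟨ +ₚ-cong (*ₚ-congʳ (c₂ *ₚ s) qa≈N₁HP) (*ₚ-congʳ (c₁ *ₚ t) qb≈N₂HT) ⟩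
    c₂ *ₚ s *ₚ (c₁ *ₚ (H *ₚ P)) +ₚ c₁ *ₚ t *ₚ (c₂ *ₚ (H *ₚ T))
      ≈⟨ factor H P T c₁ c₂ s t ⟩
    (c₁ *ₚ c₂) *ₚ H *ₚ (s *ₚ P +ₚ t *ₚ T)
      ≈⟨ *ₚ-congʳ ((c₁ *ₚ c₂) *ₚ H) e ⟩
    (c₁ *ₚ c₂) *ₚ H *ₚ const M
      ≈⟨ regroup (c₁ *ₚ c₂) H (const M) ⟩
    ((c₁ *ₚ c₂) *ₚ const M) *ₚ H
      ≈⟨ *ₚ-congˡ (≈-trans (*ₚ-congˡ (const-*ₚ-const N₁ N₂) (const M)) (const-*ₚ-const (N₁ *ℤ N₂) M)) H ⟩
    const (N₁ *ℤ N₂ *ℤ M) *ₚ H ∎))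
  where
  open ℤ[x]-Reasoning
  c₁ = const N₁
  c₂ = const N₂
  nonZero : ℤ.NonZero (N₁ *ℤ N₂ *ℤ M)
  nonZero = ℤP.i*j≢0 (N₁ *ℤ N₂) M {{ℤP.i*j≢0 N₁ N₂ {{N₁≢0}} {{N₂≢0}}}} {{M≢0}}
  expand : ∀ q a b c₁ c₂ s t → q *ₚ (c₂ *ₚ s *ₚ a +ₚ c₁ *ₚ t *ₚ b) ≈ c₂ *ₚ s *ₚ (q *ₚ a) +ₚ c₁ *ₚ t *ₚ (q *ₚ b)
  expand = solve-∀ ℤ[x]-solverRing
  factor : ∀ H P T c₁ c₂ s t → c₂ *ₚ s *ₚ (c₁ *ₚ (H *ₚ P)) +ₚ c₁ *ₚ t *ₚ (c₂ *ₚ (H *ₚ T)) ≈ (c₁ *ₚ c₂) *ₚ H *ₚ (s *ₚ P +ₚ t *ₚ T)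
  factor = solve-∀ ℤ[x]-solverRing
  regroup : ∀ c H m → c *ₚ H *ₚ m ≈ (c *ₚ m) *ₚ H
  regroup = solve-∀ ℤ[x]-solverRing

infix 4 _∈⟨_,_⟩
record _∈⟨_,_⟩ (H B C : Poly) : Set where
  constructor mk∈⟨,⟩
  field
    α β         : Poly
    combination : α *ₚ B +ₚ β *ₚ C ≈ H

∈⟨,⟩-sym : ∀ {H B C} → H ∈⟨ B , C ⟩ → H ∈⟨ C , B ⟩
∈⟨,⟩-sym {H} {B} {C} (mk∈⟨,⟩ α β e) = mk∈⟨,⟩ β α (≈-trans (+ₚ-comm (β *ₚ C) (α *ₚ B)) e)

coprimeℚ-via-ideal : ∀ {A H B C P} → Coprimeℚ A H → H ∈⟨ B , C ⟩ → P ∣ₓ B → A ∣ₓ C → Coprimeℚ A P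
coprimeℚ-via-ideal {A} {H} {B} {C} {P} (mkCoprimeℚ s t N N≢0 e) (mk∈⟨,⟩ α β f) (mk∣ₓ y Py≈B) (mk∣ₓ z Az≈C) =
  mkCoprimeℚ (s +ₚ t *ₚ (β *ₚ z)) (t *ₚ (α *ₚ y)) N N≢0 (begin
    (s +ₚ t *ₚ (β *ₚ z)) *ₚ A +ₚ (t *ₚ (α *ₚ y)) *ₚ P
      ≈⟨ expand A P s t α β y z ⟩
    s *ₚ A +ₚ t *ₚ (α *ₚ (P *ₚ y) +ₚ β *ₚ (A *ₚ z))
      ≈⟨ +ₚ-cong ≈-refl (*ₚ-congʳ t (≈-trans (+ₚ-cong (*ₚ-congʳ α Py≈B) (*ₚ-congʳ β Az≈C)) f)) ⟩
    s *ₚ A +ₚ t *ₚ H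
      ≈⟨ e ⟩
    const N ∎)
  where
  open ℤ[x]-Reasoning
  expand : ∀ A P s t α β y z → (s +ₚ t *ₚ (β *ₚ z)) *ₚ A +ₚ (t *ₚ (α *ₚ y)) *ₚ P ≈ s *ₚ A +ₚ t *ₚ (α *ₚ (P *ₚ y) +ₚ β *ₚ (A *ₚ z))
  expand = solve-∀ ℤ[x]-solverRing

-- The Euler operator and the polynomials x^d − 1

x∂ : Poly → Poly
x∂ []      = []
x∂ (a ∷ p) = shift (p +ₚ x∂ p)

coeff-x∂ : ∀ p k → coeff (x∂ p) k ≡ + k *ℤ coeff p k
coeff-x∂ []      k       = sym (ℤP.*-zeroʳ (+ k))
coeff-x∂ (a ∷ p) zero    = refl
coeff-x∂ (a ∷ p) (suc k) = begin
  coeff (p +ₚ x∂ p) k                    ≡⟨ coeff-+ₚ p (x∂ p) k ⟩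
  coeff p k +ℤ coeff (x∂ p) k            ≡⟨ cong (coeff p k +ℤ_) (coeff-x∂ p k) ⟩
  coeff p k +ℤ + k *ℤ coeff p k          ≡⟨ cong (_+ℤ + k *ℤ coeff p k) (ℤP.*-identityˡ (coeff p k)) ⟨
  + 1 *ℤ coeff p k +ℤ + k *ℤ coeff p k   ≡⟨ ℤP.*-distribʳ-+ (coeff p k) (+ 1) (+ k) ⟨
  + suc k *ℤ coeff p k                   ∎
  where open ≡-Reasoning

x∂-cong : ∀ {p q} → p ≈ q → x∂ p ≈ x∂ q
x∂-cong {p} {q} e = mk≈ λ k → trans (coeff-x∂ p k) (trans (cong (+ k *ℤ_) (at e k)) (sym (coeff-x∂ q k)))

x∂-+ₚ : ∀ p q → x∂ (p +ₚ q) ≈ x∂ p +ₚ x∂ q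
x∂-+ₚ p q = mk≈ λ k → begin
  coeff (x∂ (p +ₚ q)) k                     ≡⟨ coeff-x∂ (p +ₚ q) k ⟩
  + k *ℤ coeff (p +ₚ q) k                   ≡⟨ cong (+ k *ℤ_) (coeff-+ₚ p q k) ⟩
  + k *ℤ (coeff p k +ℤ coeff q k)           ≡⟨ ℤP.*-distribˡ-+ (+ k) (coeff p k) _ ⟩
  + k *ℤ coeff p k +ℤ + k *ℤ coeff q k      ≡⟨ cong₂ _+ℤ_ (coeff-x∂ p k) (coeff-x∂ q k) ⟨
  coeff (x∂ p) k +ℤ coeff (x∂ q) k          ≡⟨ coeff-+ₚ (x∂ p) (x∂ q) k ⟨
  coeff (x∂ p +ₚ x∂ q) k                    ∎
  where open ≡-Reasoning

x∂-scale : ∀ a p → x∂ (scale a p) ≈ scale a (x∂ p)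
x∂-scale a p = mk≈ λ k → begin
  coeff (x∂ (scale a p)) k          ≡⟨ coeff-x∂ (scale a p) k ⟩
  + k *ℤ coeff (scale a p) k        ≡⟨ cong (+ k *ℤ_) (coeff-scale a p k) ⟩
  + k *ℤ (a *ℤ coeff p k)           ≡⟨ ℤP.*-assoc (+ k) a _ ⟨
  (+ k *ℤ a) *ℤ coeff p k           ≡⟨ cong (_*ℤ coeff p k) (ℤP.*-comm (+ k) a) ⟩
  (a *ℤ + k) *ℤ coeff p k           ≡⟨ ℤP.*-assoc a (+ k) _ ⟩
  a *ℤ (+ k *ℤ coeff p k)           ≡⟨ cong (a *ℤ_) (coeff-x∂ p k) ⟨
  a *ℤ coeff (x∂ p) k               ≡⟨ coeff-scale a (x∂ p) k ⟨
  coeff (scale a (x∂ p)) k          ∎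
  where open ≡-Reasoning

xₚ : Poly
xₚ = shift oneₚ

shift≈xₚ*ₚ : ∀ p → shift p ≈ xₚ *ₚ p
shift≈xₚ*ₚ p = ≈-sym (+ₚ-cong (scale-zero p) (∷-cong refl (*ₚ-identityˡ p)))

x∂-*ₚ : ∀ p q → x∂ (p *ₚ q) ≈ x∂ p *ₚ q +ₚ p *ₚ x∂ q
x∂-*ₚ []      q = ≈-refl
x∂-*ₚ (a ∷ p) q = begin
  x∂ (scale a q +ₚ shift (p *ₚ q))
    ≈⟨ x∂-+ₚ (scale a q) (shift (p *ₚ q)) ⟩
  x∂ (scale a q) +ₚ shift (p *ₚ q +ₚ x∂ (p *ₚ q))
    ≈⟨ +ₚ-cong (≈-trans (x∂-scale a q) (≈-sym (const-*ₚ a (x∂ q))))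
               (≈-trans (∷-cong refl (+ₚ-cong ≈-refl (x∂-*ₚ p q))) (shift≈xₚ*ₚ _)) ⟩
  const a *ₚ x∂ q +ₚ xₚ *ₚ (p *ₚ q +ₚ (x∂ p *ₚ q +ₚ p *ₚ x∂ q))
    ≈⟨ leibniz (const a) xₚ p q (x∂ p) (x∂ q) ⟩
  (xₚ *ₚ (p +ₚ x∂ p)) *ₚ q +ₚ (const a *ₚ x∂ q +ₚ xₚ *ₚ (p *ₚ x∂ q))
    ≈⟨ +ₚ-cong (*ₚ-congˡ (≈-sym (shift≈xₚ*ₚ (p +ₚ x∂ p))) q)
               (+ₚ-cong (const-*ₚ a (x∂ q)) (≈-sym (shift≈xₚ*ₚ (p *ₚ x∂ q)))) ⟩
  x∂ (a ∷ p) *ₚ q +ₚ (a ∷ p) *ₚ x∂ q ∎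
  where
  open ℤ[x]-Reasoning
  leibniz : ∀ c x p q p′ q′ → c *ₚ q′ +ₚ x *ₚ (p *ₚ q +ₚ (p′ *ₚ q +ₚ p *ₚ q′)) ≈ (x *ₚ (p +ₚ p′)) *ₚ q +ₚ (c *ₚ q′ +ₚ x *ₚ (p *ₚ q′))
  leibniz = solve-∀ ℤ[x]-solverRing

-- The Bézout identity is (x∂R + G R) A + (x∂A) R = x∂F + G F = N.
separable⇒coprimeℚ-factors : ∀ {F G A R} N {{N≢0 : ℤ.NonZero N}} → x∂ F +ₚ G *ₚ F ≈ const N → A *ₚ R ≈ F → Coprimeℚ A R
separable⇒coprimeℚ-factors {F} {G} {A} {R} N {{N≢0}} e AR≈F = mkCoprimeℚ (x∂ R +ₚ G *ₚ R) (x∂ A) N N≢0 (begin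
  (x∂ R +ₚ G *ₚ R) *ₚ A +ₚ x∂ A *ₚ R          ≈⟨ regroup A R (x∂ A) (x∂ R) G ⟩
  (x∂ A *ₚ R +ₚ A *ₚ x∂ R) +ₚ G *ₚ (A *ₚ R)   ≈⟨ +ₚ-cong (≈-sym (x∂-*ₚ A R)) ≈-refl ⟩
  x∂ (A *ₚ R) +ₚ G *ₚ (A *ₚ R)                ≈⟨ +ₚ-cong (x∂-cong AR≈F) (*ₚ-congʳ G AR≈F) ⟩
  x∂ F +ₚ G *ₚ F                              ≈⟨ e ⟩
  const N                                     ∎)
  where
  open ℤ[x]-Reasoning
  regroup : ∀ A R A′ R′ G → (R′ +ₚ G *ₚ R) *ₚ A +ₚ A′ *ₚ R ≈ (A′ *ₚ R +ₚ A *ₚ R′) +ₚ G *ₚ (A *ₚ R)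
  regroup = solve-∀ ℤ[x]-solverRing

xpow-+ : ∀ a b → xpow (a + b) ≈ xpow a *ₚ xpow b
xpow-+ zero    b = ≈-sym (*ₚ-identityˡ (xpow b))
xpow-+ (suc a) b = ≈-trans (∷-cong refl (xpow-+ a b)) (≈-sym (shift-*ₚ (xpow a) (xpow b)))

x∂-xpow : ∀ d → x∂ (xpow d) ≈ const (+ d) *ₚ xpow d
x∂-xpow zero    = mk≈ λ { zero → refl ; (suc k) → refl }
x∂-xpow (suc d) = begin
  shift (xpow d +ₚ x∂ (xpow d))                       ≈⟨ ∷-cong refl (+ₚ-cong (≈-sym (*ₚ-identityˡ (xpow d))) (x∂-xpow d)) ⟩
  shift (oneₚ *ₚ xpow d +ₚ const (+ d) *ₚ xpow d)     ≈⟨ ∷-cong refl (≈-sym (*ₚ-distribʳ (xpow d) oneₚ (const (+ d)))) ⟩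
  shift (const (+ suc d) *ₚ xpow d)                   ≈⟨ ∷-cong refl (const-*ₚ (+ suc d) (xpow d)) ⟩
  shift (scale (+ suc d) (xpow d))                    ≈⟨ scale-shift (+ suc d) (xpow d) ⟨
  scale (+ suc d) (xpow (suc d))                      ≈⟨ const-*ₚ (+ suc d) (xpow (suc d)) ⟨
  const (+ suc d) *ₚ xpow (suc d)                     ∎
  where open ℤ[x]-Reasoning

infix 10 x^_−1
x^_−1 : ℕ → Poly
x^ d −1 = xpow d -ₚ oneₚ

x^+−1 : ∀ a b → x^ (a + b) −1 ≈ xpow a *ₚ x^ b −1 +ₚ x^ a −1
x^+−1 a b = ≈-trans (+ₚ-cong (xpow-+ a b) ≈-refl) (telescope (xpow a) (xpow b))
  where
  telescope : ∀ u v → u *ₚ v -ₚ oneₚ ≈ u *ₚ (v -ₚ oneₚ) +ₚ (u -ₚ oneₚ)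
  telescope = solve-∀ ℤ[x]-solverRing

x^−1-∣ₓ-x^*−1 : ∀ k m → x^ k −1 ∣ₓ x^ (m * k) −1
x^−1-∣ₓ-x^*−1 k zero    = mk∣ₓ [] (≈-trans (*ₚ-zeroʳ (x^ k −1)) (mk≈ λ { zero → refl ; (suc j) → refl }))
x^−1-∣ₓ-x^*−1 k (suc m) = ∣ₓ-respʳ-≈ (∣ₓ-+ₚ (∣ₓ-*ˡ (xpow k) (x^−1-∣ₓ-x^*−1 k m)) (∣ₓ-refl (x^ k −1))) (≈-sym (x^+−1 k (m * k)))

∣⇒x^−1-∣ₓ : ∀ {k m} → k ∣ m → x^ k −1 ∣ₓ x^ m −1
∣⇒x^−1-∣ₓ {k} (divides q refl) = x^−1-∣ₓ-x^*−1 k q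

unitConst-x^−1 : ∀ d → 1 ≤ d → UnitConst (x^ d −1)
unitConst-x^−1 (suc d) _ = mkUnitConst (inj₂ refl)

x∂-x^−1 : ∀ d → x∂ (x^ d −1) +ₚ negₚ (const (+ d)) *ₚ x^ d −1 ≈ const (+ d)
x∂-x^−1 d = begin
  x∂ (x^ d −1) +ₚ negₚ c *ₚ x^ d −1                              ≈⟨ +ₚ-cong (x∂-+ₚ (xpow d) (negₚ oneₚ)) ≈-refl ⟩
  (x∂ (xpow d) +ₚ shift []) +ₚ negₚ c *ₚ x^ d −1                 ≈⟨ +ₚ-cong (+ₚ-cong (x∂-xpow d) shift-[]) ≈-refl ⟩
  (c *ₚ xpow d +ₚ []) +ₚ negₚ c *ₚ (xpow d -ₚ oneₚ)              ≈⟨ euler c (xpow d) ⟩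
  c                                                              ∎
  where
  open ℤ[x]-Reasoning
  c = const (+ d)
  euler : ∀ c u → (c *ₚ u +ₚ []) +ₚ negₚ c *ₚ (u -ₚ oneₚ) ≈ c
  euler = solve-∀ ℤ[x]-solverRing

coprimeℚ-factors-x^−1 : ∀ d → 1 ≤ d → ∀ {A R} → A *ₚ R ≈ x^ d −1 → Coprimeℚ A R
coprimeℚ-factors-x^−1 (suc d) _ = separable⇒coprimeℚ-factors {G = negₚ (const (+ suc d))} (+ suc d) (x∂-x^−1 (suc d))

∈⟨,⟩-difference : ∀ {B C g u v} w → B ∣ₓ u → C ∣ₓ v → u ≈ w *ₚ v +ₚ g → g ∈⟨ B , C ⟩
∈⟨,⟩-difference {B} {C} {g} {u} {v} w (mk∣ₓ r Br≈u) (mk∣ₓ s Cs≈v) u≈wv+g =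
  mk∈⟨,⟩ r (negₚ (w *ₚ s)) (begin
    r *ₚ B +ₚ negₚ (w *ₚ s) *ₚ C          ≈⟨ regroup B C r s w ⟩
    B *ₚ r -ₚ w *ₚ (C *ₚ s)               ≈⟨ +ₚ-cong Br≈u (negₚ-cong (*ₚ-congʳ w Cs≈v)) ⟩
    u -ₚ w *ₚ v                           ≈⟨ +ₚ-cong u≈wv+g ≈-refl ⟩
    (w *ₚ v +ₚ g) -ₚ w *ₚ v               ≈⟨ cancel (w *ₚ v) g ⟩
    g                                     ∎)
  where
  open ℤ[x]-Reasoning
  regroup : ∀ B C r s w → r *ₚ B +ₚ negₚ (w *ₚ s) *ₚ C ≈ B *ₚ r -ₚ w *ₚ (C *ₚ s)
  regroup = solve-∀ ℤ[x]-solverRing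
  cancel : ∀ a g → (a +ₚ g) -ₚ a ≈ g
  cancel = solve-∀ ℤ[x]-solverRing

-- From the Bézout identity gcd m n + b n = a m, since x^(gcd+bn) − 1 = x^gcd (x^bn − 1) + (x^gcd − 1).
x^gcd−1∈⟨x^−1,x^−1⟩ : ∀ m n → x^ (gcd m n) −1 ∈⟨ x^ m −1 , x^ n −1 ⟩
x^gcd−1∈⟨x^−1,x^−1⟩ m n with Bézout.identity (gcd-GCD m n)
... | Bézout.+- a b eq = ∈⟨,⟩-difference (xpow (gcd m n)) (x^−1-∣ₓ-x^*−1 m a) (x^−1-∣ₓ-x^*−1 n b)
        (subst (λ z → x^ z −1 ≈ xpow (gcd m n) *ₚ x^ (b * n) −1 +ₚ x^ (gcd m n) −1) eq (x^+−1 (gcd m n) (b * n)))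
... | Bézout.-+ a b eq = ∈⟨,⟩-sym (∈⟨,⟩-difference (xpow (gcd m n)) (x^−1-∣ₓ-x^*−1 n b) (x^−1-∣ₓ-x^*−1 m a)
        (subst (λ z → x^ z −1 ≈ xpow (gcd m n) *ₚ x^ (a * m) −1 +ₚ x^ (gcd m n) −1) eq (x^+−1 (gcd m n) (a * m))))

-- Finite sums and products

infix 4 _∈[1,_]
_∈[1,_] : ℕ → ℕ → Set
k ∈[1, D ] = 1 ≤ k × k ≤ D

∈[1,]-suc : ∀ {k D} → k ∈[1, D ] → k ∈[1, suc D ]
∈[1,]-suc (1≤k , k≤D) = 1≤k , ℕP.m≤n⇒m≤1+n k≤D

∈[1,]-top : ∀ D → suc D ∈[1, suc D ]
∈[1,]-top D = s≤s z≤n , ℕP.≤-refl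

∈[1,]-below-top : ∀ {k D} → k ∈[1, D ] → k ≢ suc D
∈[1,]-below-top (_ , k≤D) refl = ℕP.<-irrefl refl (s≤s k≤D)

∈[1,suc]-split : ∀ {k D} → k ∈[1, suc D ] → k ≡ suc D ⊎ k ∈[1, D ]
∈[1,suc]-split {k} {D} (1≤k , k≤1+D) with k ℕ.≟ suc D
... | yes k≡1+D = inj₁ k≡1+D
... | no  k≢1+D = inj₂ (1≤k , ℕP.≤-pred (ℕP.≤∧≢⇒< k≤1+D k≢1+D))

sumFrom1-cong : ∀ n {f g} → (∀ i → i ∈[1, n ] → f i ≡ g i) → sumFrom1 n f ≡ sumFrom1 n g
sumFrom1-cong zero    f≗g = refl
sumFrom1-cong (suc n) f≗g = cong₂ _+_ (sumFrom1-cong n λ i r → f≗g i (∈[1,]-suc r)) (f≗g (suc n) (∈[1,]-top n))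

sumFrom1-mono-≤ : ∀ n {f g} → (∀ i → i ∈[1, n ] → f i ≤ g i) → sumFrom1 n f ≤ sumFrom1 n g
sumFrom1-mono-≤ zero    f≤g = z≤n
sumFrom1-mono-≤ (suc n) f≤g = ℕP.+-mono-≤ (sumFrom1-mono-≤ n λ i r → f≤g i (∈[1,]-suc r)) (f≤g (suc n) (∈[1,]-top n))

sumFrom1-zero : ∀ n {f} → (∀ i → i ∈[1, n ] → f i ≡ 0) → sumFrom1 n f ≡ 0
sumFrom1-zero zero    f≗0 = refl
sumFrom1-zero (suc n) f≗0 = cong₂ _+_ (sumFrom1-zero n λ i r → f≗0 i (∈[1,]-suc r)) (f≗0 (suc n) (∈[1,]-top n))

sumFrom1-distrib-+ : ∀ n (f g : ℕ → ℕ) → sumFrom1 n (λ i → f i + g i) ≡ sumFrom1 n f + sumFrom1 n g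
sumFrom1-distrib-+ zero    f g = refl
sumFrom1-distrib-+ (suc n) f g = trans (cong (_+ (f (suc n) + g (suc n))) (sumFrom1-distrib-+ n f g))
  (interchange (sumFrom1 n f) (sumFrom1 n g) (f (suc n)) (g (suc n)))
  where
  interchange : ∀ a b c d → a + b + (c + d) ≡ a + c + (b + d)
  interchange = ℕ-Solver.solve-∀

sumFrom1-*ʳ : ∀ n (f : ℕ → ℕ) c → sumFrom1 n f * c ≡ sumFrom1 n (λ i → f i * c)
sumFrom1-*ʳ zero    f c = refl
sumFrom1-*ʳ (suc n) f c = trans (ℕP.*-distribʳ-+ c (sumFrom1 n f) (f (suc n))) (cong (_+ f (suc n) * c) (sumFrom1-*ʳ n f c))

sumFrom1-swap : ∀ n m (F : ℕ → ℕ → ℕ) → sumFrom1 n (λ i → sumFrom1 m (F i)) ≡ sumFrom1 m (λ j → sumFrom1 n (λ i → F i j))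
sumFrom1-swap zero    m F = sym (sumFrom1-zero m λ _ _ → refl)
sumFrom1-swap (suc n) m F = trans (cong (_+ sumFrom1 m (F (suc n))) (sumFrom1-swap n m F))
  (sym (sumFrom1-distrib-+ m (λ j → sumFrom1 n (λ i → F i j)) (F (suc n))))

sumFrom1-const : ∀ n c → sumFrom1 n (λ _ → c) ≡ n * c
sumFrom1-const zero    c = refl
sumFrom1-const (suc n) c = trans (cong (_+ c) (sumFrom1-const n c)) (ℕP.+-comm (n * c) c)

δ : ℕ → ℕ → ℕ
δ j k with k ℕ.≟ j
... | yes _ = 1
... | no  _ = 0

δ-refl : ∀ j → δ j j ≡ 1
δ-refl j with j ℕ.≟ j
... | yes _   = refl
... | no  j≢j = ⊥-elim (j≢j refl)

δ-≢ : ∀ j k → k ≢ j → δ j k ≡ 0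
δ-≢ j k k≢j with k ℕ.≟ j
... | yes k≡j = ⊥-elim (k≢j k≡j)
... | no  _   = refl

δ-sym : ∀ a b → δ a b ≡ δ b a
δ-sym a b with b ℕ.≟ a | a ℕ.≟ b
... | yes _   | yes _   = refl
... | no  _   | no  _   = refl
... | yes b≡a | no  a≢b = ⊥-elim (a≢b (sym b≡a))
... | no  b≢a | yes a≡b = ⊥-elim (b≢a (sym a≡b))

sumFrom1-δ-above : ∀ n (f : ℕ → ℕ) {j} → n < j → sumFrom1 n (λ i → δ j i * f i) ≡ 0
sumFrom1-δ-above n f n<j = sumFrom1-zero n λ i (_ , i≤n) →
  cong (_* f i) (δ-≢ _ i λ { refl → ℕP.<-irrefl refl (ℕP.≤-<-trans i≤n n<j) })

sumFrom1-δ : ∀ n (f : ℕ → ℕ) j → j ∈[1, n ] → sumFrom1 n (λ i → δ j i * f i) ≡ f j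
sumFrom1-δ zero    f j (s≤s z≤n , ())
sumFrom1-δ (suc n) f j r with ∈[1,suc]-split r
... | inj₁ refl = begin
  sumFrom1 n (λ i → δ j i * f i) + δ j j * f j   ≡⟨ cong₂ _+_ (sumFrom1-δ-above n f ℕP.≤-refl) (cong (_* f j) (δ-refl j)) ⟩
  0 + 1 * f j                                    ≡⟨ ℕP.*-identityˡ (f j) ⟩
  f j                                            ∎
  where open ≡-Reasoning
... | inj₂ r′ = begin
  sumFrom1 n (λ i → δ j i * f i) + δ j (suc n) * f (suc n)
    ≡⟨ cong₂ _+_ (sumFrom1-δ n f j r′) (cong (_* f (suc n)) (δ-≢ j (suc n) (≢-sym (∈[1,]-below-top r′)))) ⟩
  f j + 0
    ≡⟨ ℕP.+-identityʳ (f j) ⟩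
  f j ∎
  where open ≡-Reasoning

sumFrom1-δ-≤ : ∀ n (f : ℕ → ℕ) j → sumFrom1 n (λ i → δ j i * f i) ≤ f j
sumFrom1-δ-≤ zero    f j = z≤n
sumFrom1-δ-≤ (suc n) f j with j ℕ.≟ suc n
... | yes refl = ℕP.≤-reflexive (sumFrom1-δ (suc n) f j (∈[1,]-top n))
... | no  j≢1+n = begin
  sumFrom1 n (λ i → δ j i * f i) + δ j (suc n) * f (suc n)
    ≡⟨ cong (_+_ (sumFrom1 n (λ i → δ j i * f i))) (cong (_* f (suc n)) (δ-≢ j (suc n) (≢-sym j≢1+n))) ⟩
  sumFrom1 n (λ i → δ j i * f i) + 0
    ≡⟨ ℕP.+-identityʳ _ ⟩
  sumFrom1 n (λ i → δ j i * f i)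
    ≤⟨ sumFrom1-δ-≤ n f j ⟩
  f j ∎
  where open ℕP.≤-Reasoning

^ₚ-cong : ∀ {p q} → p ≈ q → ∀ m → p ^ₚ m ≈ q ^ₚ m
^ₚ-cong e zero    = ≈-refl
^ₚ-cong e (suc m) = *ₚ-cong e (^ₚ-cong e m)

^ₚ-distribˡ-+ : ∀ p a b → p ^ₚ (a + b) ≈ p ^ₚ a *ₚ p ^ₚ b
^ₚ-distribˡ-+ p zero    b = ≈-sym (*ₚ-identityˡ _)
^ₚ-distribˡ-+ p (suc a) b = ≈-trans (*ₚ-congʳ p (^ₚ-distribˡ-+ p a b)) (≈-sym (*ₚ-assoc p (p ^ₚ a) (p ^ₚ b)))

^ₚ-distribʳ-*ₚ : ∀ p q m → (p *ₚ q) ^ₚ m ≈ p ^ₚ m *ₚ q ^ₚ m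
^ₚ-distribʳ-*ₚ p q zero    = ≈-sym (*ₚ-identityˡ oneₚ)
^ₚ-distribʳ-*ₚ p q (suc m) = ≈-trans (*ₚ-congʳ (p *ₚ q) (^ₚ-distribʳ-*ₚ p q m)) (interchange p q (p ^ₚ m) (q ^ₚ m))
  where
  interchange : ∀ p q a b → (p *ₚ q) *ₚ (a *ₚ b) ≈ (p *ₚ a) *ₚ (q *ₚ b)
  interchange = solve-∀ ℤ[x]-solverRing

^ₚ-*ₚ : ∀ p a b → (p ^ₚ a) ^ₚ b ≈ p ^ₚ (b * a)
^ₚ-*ₚ p a zero    = ≈-refl
^ₚ-*ₚ p a (suc b) = ≈-trans (*ₚ-congʳ (p ^ₚ a) (^ₚ-*ₚ p a b)) (≈-sym (^ₚ-distribˡ-+ p a (b * a)))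

oneₚ-^ₚ : ∀ m → oneₚ ^ₚ m ≈ oneₚ
oneₚ-^ₚ zero    = ≈-refl
oneₚ-^ₚ (suc m) = ≈-trans (*ₚ-identityˡ _) (oneₚ-^ₚ m)

unitConst-^ₚ : ∀ {p} → UnitConst p → ∀ m → UnitConst (p ^ₚ m)
unitConst-^ₚ u zero    = mkUnitConst (inj₁ refl)
unitConst-^ₚ u (suc m) = unitConst-*ₚ u (unitConst-^ₚ u m)

prodFrom1-cong : ∀ D {f g} → (∀ k → k ∈[1, D ] → f k ≈ g k) → prodFrom1 D f ≈ prodFrom1 D g
prodFrom1-cong zero    f≈g = ≈-refl
prodFrom1-cong (suc D) f≈g = *ₚ-cong (prodFrom1-cong D λ k r → f≈g k (∈[1,]-suc r)) (f≈g (suc D) (∈[1,]-top D))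

prodFrom1-oneₚ : ∀ D {f} → (∀ k → k ∈[1, D ] → f k ≈ oneₚ) → prodFrom1 D f ≈ oneₚ
prodFrom1-oneₚ zero    f≈1 = ≈-refl
prodFrom1-oneₚ (suc D) f≈1 =
  ≈-trans (*ₚ-cong (prodFrom1-oneₚ D λ k r → f≈1 k (∈[1,]-suc r)) (f≈1 (suc D) (∈[1,]-top D))) (*ₚ-identityˡ oneₚ)

prodFrom1-*ₚ : ∀ D f g → prodFrom1 D f *ₚ prodFrom1 D g ≈ prodFrom1 D (λ k → f k *ₚ g k)
prodFrom1-*ₚ zero    f g = *ₚ-identityˡ oneₚ
prodFrom1-*ₚ (suc D) f g =
  ≈-trans (interchange (prodFrom1 D f) (prodFrom1 D g) (f (suc D)) (g (suc D))) (*ₚ-congˡ (prodFrom1-*ₚ D f g) _)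
  where
  interchange : ∀ a b c d → (a *ₚ c) *ₚ (b *ₚ d) ≈ (a *ₚ b) *ₚ (c *ₚ d)
  interchange = solve-∀ ℤ[x]-solverRing

prodFrom1-^ₚ : ∀ D f m → prodFrom1 D f ^ₚ m ≈ prodFrom1 D (λ k → f k ^ₚ m)
prodFrom1-^ₚ zero    f m = oneₚ-^ₚ m
prodFrom1-^ₚ (suc D) f m = ≈-trans (^ₚ-distribʳ-*ₚ (prodFrom1 D f) (f (suc D)) m) (*ₚ-congˡ (prodFrom1-^ₚ D f m) _)

unitConst-prodFrom1 : ∀ D {f} → (∀ k → k ∈[1, D ] → UnitConst (f k)) → UnitConst (prodFrom1 D f)
unitConst-prodFrom1 zero    u = mkUnitConst (inj₁ refl)
unitConst-prodFrom1 (suc D) u = unitConst-*ₚ (unitConst-prodFrom1 D λ k r → u k (∈[1,]-suc r)) (u (suc D) (∈[1,]-top D))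

coprimeℚ-prodFrom1ʳ : ∀ D {A f} → (∀ k → k ∈[1, D ] → Coprimeℚ A (f k)) → Coprimeℚ A (prodFrom1 D f)
coprimeℚ-prodFrom1ʳ zero    c = coprimeℚ-oneʳ _
coprimeℚ-prodFrom1ʳ (suc D) c = coprimeℚ-*ʳ (coprimeℚ-prodFrom1ʳ D λ k r → c k (∈[1,]-suc r)) (c (suc D) (∈[1,]-top D))

prodPow : (ℕ → Poly) → ℕ → (ℕ → ℕ) → Poly
prodPow Φ D E = prodFrom1 D (λ k → Φ k ^ₚ E k)

prodPow-congʳ : ∀ Φ D {E E′} → (∀ k → k ∈[1, D ] → E k ≡ E′ k) → prodPow Φ D E ≈ prodPow Φ D E′
prodPow-congʳ Φ D E≗E′ = prodFrom1-cong D λ k r → ≡⇒≈ (cong (Φ k ^ₚ_) (E≗E′ k r))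

prodPow-congˡ : ∀ {Φ Ψ} D E → (∀ k → k ∈[1, D ] → Φ k ≡ Ψ k) → prodPow Φ D E ≈ prodPow Ψ D E
prodPow-congˡ D E Φ≗Ψ = prodFrom1-cong D λ k r → ≡⇒≈ (cong (_^ₚ E k) (Φ≗Ψ k r))

prodPow-+ : ∀ Φ D E F → prodPow Φ D E *ₚ prodPow Φ D F ≈ prodPow Φ D (λ k → E k + F k)
prodPow-+ Φ D E F = ≈-trans (prodFrom1-*ₚ D _ _) (prodFrom1-cong D λ k _ → ≈-sym (^ₚ-distribˡ-+ (Φ k) (E k) (F k)))

prodPow-^ₚ : ∀ Φ D E m → prodPow Φ D E ^ₚ m ≈ prodPow Φ D (λ k → m * E k)
prodPow-^ₚ Φ D E m = ≈-trans (prodFrom1-^ₚ D _ m) (prodFrom1-cong D λ k _ → ^ₚ-*ₚ (Φ k) (E k) m)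

prodPow-zero : ∀ Φ D → prodPow Φ D (λ _ → 0) ≈ oneₚ
prodPow-zero Φ D = prodFrom1-oneₚ D λ _ _ → ≈-refl

unitConst-prodPow : ∀ Φ D E → (∀ k → k ∈[1, D ] → UnitConst (Φ k)) → UnitConst (prodPow Φ D E)
unitConst-prodPow Φ D E u = unitConst-prodFrom1 D λ k r → unitConst-^ₚ (u k r) (E k)

prodPow-split : ∀ Φ D {E F} → (∀ k → k ∈[1, D ] → E k ≤ F k) → prodPow Φ D F ≈ prodPow Φ D E *ₚ prodPow Φ D (λ k → F k ∸ E k)
prodPow-split Φ D {E} E≤F = ≈-sym (≈-trans (prodPow-+ Φ D E _) (prodPow-congʳ Φ D λ k r → ℕP.m+[n∸m]≡n (E≤F k r)))

prodPow-∣ₓ : ∀ Φ D {E F} → (∀ k → k ∈[1, D ] → E k ≤ F k) → prodPow Φ D E ∣ₓ prodPow Φ D F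
prodPow-∣ₓ Φ D E≤F = mk∣ₓ _ (≈-sym (prodPow-split Φ D E≤F))

prodPow-δ : ∀ Φ D j → j ∈[1, D ] → prodPow Φ D (δ j) ≈ Φ j
prodPow-δ Φ zero    j (s≤s z≤n , ())
prodPow-δ Φ (suc D) j r with ∈[1,suc]-split r
... | inj₁ refl = ≈-trans (*ₚ-cong (≈-trans (prodPow-congʳ Φ D λ k r′ → δ-≢ j k (∈[1,]-below-top r′)) (prodPow-zero Φ D))
                                   (≡⇒≈ (cong (Φ j ^ₚ_) (δ-refl j))))
                          (≈-trans (*ₚ-identityˡ _) (*ₚ-identityʳ _))
... | inj₂ r′ = ≈-trans (*ₚ-cong (prodPow-δ Φ D j r′) (≡⇒≈ (cong (Φ (suc D) ^ₚ_) (δ-≢ j (suc D) (≢-sym (∈[1,]-below-top r′))))))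
                        (*ₚ-identityʳ _)

factor-∣ₓ-prodPow : ∀ Φ D j {E} → j ∈[1, D ] → 1 ≤ E j → Φ j ∣ₓ prodPow Φ D E
factor-∣ₓ-prodPow Φ D j {E} r 1≤Ej = ∣ₓ-respˡ-≈ (prodPow-δ Φ D j r) (prodPow-∣ₓ Φ D λ k _ → δ≤E k)
  where
  δ≤E : ∀ k → δ j k ≤ E k
  δ≤E k with k ℕ.≟ j
  ... | yes refl = 1≤Ej
  ... | no  _    = z≤n

prodFrom1-prodPow : ∀ Φ D n (E : ℕ → ℕ → ℕ) → prodFrom1 n (λ i → prodPow Φ D (E i)) ≈ prodPow Φ D (λ k → sumFrom1 n (λ i → E i k))
prodFrom1-prodPow Φ D zero    E = ≈-sym (prodPow-zero Φ D)
prodFrom1-prodPow Φ D (suc n) E =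
  ≈-trans (*ₚ-congˡ (prodFrom1-prodPow Φ D n E) _) (prodPow-+ Φ D (λ k → sumFrom1 n (λ i → E i k)) (E (suc n)))

PairwiseCoprimeℚ : (ℕ → Poly) → ℕ → Set
PairwiseCoprimeℚ Φ D = ∀ k j → k ∈[1, D ] → j ∈[1, D ] → k ≢ j → Coprimeℚ (Φ k) (Φ j)

prodPow-∣ₓ-of-coprime-divisors : ∀ Φ D E F → (∀ k → E k ≤ 1) → (∀ k → k ∈[1, D ] → 1 ≤ E k → Φ k ∣ₓ F) →
  PairwiseCoprimeℚ Φ D → (∀ k → k ∈[1, D ] → UnitConst (Φ k)) → prodPow Φ D E ∣ₓ F
prodPow-∣ₓ-of-coprime-divisors Φ zero    E F E≤1 Φ∣F cop u = mk∣ₓ F (*ₚ-identityˡ F)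
prodPow-∣ₓ-of-coprime-divisors Φ (suc D) E F E≤1 Φ∣F cop u = lastFactor (E (suc D)) refl
  where
  IH : prodPow Φ D E ∣ₓ F
  IH = prodPow-∣ₓ-of-coprime-divisors Φ D E F E≤1 (λ k r → Φ∣F k (∈[1,]-suc r))
         (λ k j r s → cop k j (∈[1,]-suc r) (∈[1,]-suc s)) (λ k r → u k (∈[1,]-suc r))
  coprime : Coprimeℚ (prodPow Φ D E) (Φ (suc D))
  coprime = coprimeℚ-sym (coprimeℚ-prodFrom1ʳ D λ k r →
    coprimeℚ-^ʳ (cop (suc D) k (∈[1,]-top D) (∈[1,]-suc r) (≢-sym (∈[1,]-below-top r))) (E k))
  unitConst-ΠΦ : UnitConst (prodPow Φ D E *ₚ Φ (suc D))
  unitConst-ΠΦ = unitConst-*ₚ (unitConst-prodPow Φ D E λ k r → u k (∈[1,]-suc r)) (u (suc D) (∈[1,]-top D))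
  lastFactor : ∀ e → E (suc D) ≡ e → prodPow Φ D E *ₚ Φ (suc D) ^ₚ e ∣ₓ F
  lastFactor zero          _  = ∣ₓ-respˡ-≈ (≈-sym (*ₚ-identityʳ _)) IH
  lastFactor (suc zero)    eq = ∣ₓ-respˡ-≈ (*ₚ-congʳ (prodPow Φ D E) (≈-sym (*ₚ-identityʳ _)))
    (∣ℚ⇒∣ₓ unitConst-ΠΦ (coprimeℚ-*-∣ℚ IH (Φ∣F (suc D) (∈[1,]-top D) (ℕP.≤-reflexive (sym eq))) coprime))
  lastFactor (suc (suc _)) eq = ⊥-elim (ℕP.<⇒≱ (s≤s (s≤s z≤n)) (subst (_≤ 1) eq (E≤1 (suc D))))

-- Divisor indicators and cyclotomic polynomials

[_∣_] : ℕ → ℕ → ℕ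
[ k ∣ d ] with k ∣? d
... | yes _ = 1
... | no  _ = 0

[∣]-yes : ∀ {k d} → k ∣ d → [ k ∣ d ] ≡ 1
[∣]-yes {k} {d} k∣d with k ∣? d
... | yes _   = refl
... | no  k∤d = ⊥-elim (k∤d k∣d)

[∣]-no : ∀ {k d} → ¬ k ∣ d → [ k ∣ d ] ≡ 0
[∣]-no {k} {d} k∤d with k ∣? d
... | yes k∣d = ⊥-elim (k∤d k∣d)
... | no  _   = refl

[∣]≤1 : ∀ k d → [ k ∣ d ] ≤ 1
[∣]≤1 k d with k ∣? d
... | yes _ = ℕP.≤-refl
... | no  _ = z≤n

1≤[∣]⇒∣ : ∀ {k d} → 1 ≤ [ k ∣ d ] → k ∣ d
1≤[∣]⇒∣ {k} {d} h with k ∣? d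
... | yes k∣d = k∣d

[∣]-mono : ∀ {g d} → g ∣ d → ∀ k → [ k ∣ g ] ≤ [ k ∣ d ]
[∣]-mono {g} {d} g∣d k with k ∣? g
... | no  _   = z≤n
... | yes k∣g = ℕP.≤-reflexive (sym ([∣]-yes (∣-trans k∣g g∣d)))

record CyclotomicUpTo (Φ : ℕ → Poly) (D : ℕ) : Set where
  field
    prodPow-divisors : ∀ d → d ∈[1, D ] → prodPow Φ D [_∣ d ] ≈ x^ d −1
    unitConst        : ∀ k → k ∈[1, D ] → UnitConst (Φ k)
    pairwiseCoprime  : PairwiseCoprimeℚ Φ D

_[_≔_] : (ℕ → Poly) → ℕ → Poly → ℕ → Poly
(Φ [ d ≔ Ψ ]) k with k ℕ.≟ d
... | yes _ = Ψ
... | no  _ = Φ k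

[≔]-same : ∀ Φ d Ψ → (Φ [ d ≔ Ψ ]) d ≡ Ψ
[≔]-same Φ d Ψ with d ℕ.≟ d
... | yes _   = refl
... | no  d≢d = ⊥-elim (d≢d refl)

[≔]-other : ∀ Φ d Ψ k → k ≢ d → (Φ [ d ≔ Ψ ]) k ≡ Φ k
[≔]-other Φ d Ψ k k≢d with k ℕ.≟ d
... | yes k≡d = ⊥-elim (k≢d k≡d)
... | no  _   = refl

-- Φ_(D+1) = (x^(D+1) − 1) / ∏_{k ∣ D+1, k ≤ D} Φ_k, an exact division in ℤ[x] because the Φ_k are
-- pairwise coprime over ℚ with constant terms ±1.
module CyclotomicStep (Φ : ℕ → Poly) (D : ℕ) (cyc : CyclotomicUpTo Φ D) where
  open CyclotomicUpTo cyc

  d = suc D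

  P : Poly
  P = prodPow Φ D [_∣ d ]

  Φ∣x^−1 : ∀ k → k ∈[1, D ] → Φ k ∣ₓ x^ k −1
  Φ∣x^−1 k r = ∣ₓ-respʳ-≈ (factor-∣ₓ-prodPow Φ D k {[_∣ k ]} r (ℕP.≤-reflexive (sym ([∣]-yes (∣-refl {k})))))
                          (prodPow-divisors k r)

  P∣x^d−1 : P ∣ₓ x^ d −1
  P∣x^d−1 = prodPow-∣ₓ-of-coprime-divisors Φ D [_∣ d ] (x^ d −1) (λ k → [∣]≤1 k d)
    (λ k r h → ∣ₓ-trans (Φ∣x^−1 k r) (∣⇒x^−1-∣ₓ (1≤[∣]⇒∣ h))) pairwiseCoprime unitConst

  Ψ : Poly
  Ψ = quotient P∣x^d−1

  PΨ≈x^d−1 : P *ₚ Ψ ≈ x^ d −1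
  PΨ≈x^d−1 = equation P∣x^d−1

  Φ′ : ℕ → Poly
  Φ′ = Φ [ d ≔ Ψ ]

  Φ′-below : ∀ k → k ∈[1, D ] → Φ′ k ≡ Φ k
  Φ′-below k r = [≔]-other Φ d Ψ k (∈[1,]-below-top r)

  -- With g = gcd j d: x^g − 1 is a factor of (x^d − 1) / Ψ, hence coprime to Ψ by separability,
  -- and it lies in the ideal generated by x^j − 1 and x^d − 1.
  Ψ-coprime : ∀ j → j ∈[1, D ] → Coprimeℚ Ψ (Φ j)
  Ψ-coprime j r = coprimeℚ-via-ideal Ψ⊥x^g−1 (x^gcd−1∈⟨x^−1,x^−1⟩ j d) (Φ∣x^−1 j r)
                                     (mk∣ₓ P (≈-trans (*ₚ-comm Ψ P) PΨ≈x^d−1))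
    where
    g = gcd j d
    1≤g : 1 ≤ g
    1≤g = ℕP.n≢0⇒n>0 (gcd[m,n]≢0 j d (inj₂ λ ()))
    g∈[1,D] : g ∈[1, D ]
    g∈[1,D] = 1≤g , ℕP.≤-trans (∣⇒≤ {{ℕ.>-nonZero (proj₁ r)}} (gcd[m,n]∣m j d)) (proj₂ r)
    P-split : P ≈ x^ g −1 *ₚ prodPow Φ D (λ k → [ k ∣ d ] ∸ [ k ∣ g ])
    P-split = ≈-trans (prodPow-split Φ D λ k _ → [∣]-mono (gcd[m,n]∣n j d) k) (*ₚ-congˡ (prodPow-divisors g g∈[1,D]) _)
    Ψ⊥x^g−1 : Coprimeℚ Ψ (x^ g −1)
    Ψ⊥x^g−1 = coprimeℚ-*ʳ⁻ (coprimeℚ-factors-x^−1 d (s≤s z≤n)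
      (≈-trans (*ₚ-comm Ψ _) (≈-trans (*ₚ-congˡ (≈-sym P-split) Ψ) PΨ≈x^d−1)))

  cyclotomicUpTo : CyclotomicUpTo Φ′ d
  cyclotomicUpTo = record
    { prodPow-divisors = divisors
    ; unitConst        = units
    ; pairwiseCoprime  = coprime
    }
    where
    below : ∀ E → prodPow Φ′ D E ≈ prodPow Φ D E
    below E = prodPow-congˡ D E Φ′-below
    divisors : ∀ d′ → d′ ∈[1, d ] → prodPow Φ′ d [_∣ d′ ] ≈ x^ d′ −1
    divisors d′ r with ∈[1,suc]-split r
    ... | inj₁ refl = ≈-trans (*ₚ-cong (below [_∣ d ]) (≡⇒≈ (cong₂ _^ₚ_ ([≔]-same Φ d Ψ) ([∣]-yes (∣-refl {d})))))
                              (≈-trans (*ₚ-congʳ P (*ₚ-identityʳ Ψ)) PΨ≈x^d−1)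
    ... | inj₂ r′   = ≈-trans (*ₚ-cong (below [_∣ d′ ]) (≡⇒≈ (cong (Φ′ d ^ₚ_) ([∣]-no d∤d′))))
                              (≈-trans (*ₚ-identityʳ _) (prodPow-divisors d′ r′))
      where
      d∤d′ : ¬ d ∣ d′
      d∤d′ d∣d′ = ℕP.<⇒≱ (s≤s (proj₂ r′)) (∣⇒≤ {{ℕ.>-nonZero (proj₁ r′)}} d∣d′)
    units : ∀ k → k ∈[1, d ] → UnitConst (Φ′ k)
    units k r with ∈[1,suc]-split r
    ... | inj₁ refl = subst UnitConst (sym ([≔]-same Φ d Ψ))
                        (unitConst-*ₚ⁻ˡ (≈-trans (*ₚ-comm Ψ P) PΨ≈x^d−1) (unitConst-x^−1 d (s≤s z≤n)))
    ... | inj₂ r′   = subst UnitConst (sym (Φ′-below k r′)) (unitConst k r′)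
    coprime : PairwiseCoprimeℚ Φ′ d
    coprime k j rk rj k≢j with ∈[1,suc]-split rk | ∈[1,suc]-split rj
    ... | inj₁ refl | inj₁ refl = ⊥-elim (k≢j refl)
    ... | inj₁ refl | inj₂ rj′  = subst₂ Coprimeℚ (sym ([≔]-same Φ d Ψ)) (sym (Φ′-below j rj′)) (Ψ-coprime j rj′)
    ... | inj₂ rk′  | inj₁ refl = subst₂ Coprimeℚ (sym (Φ′-below k rk′)) (sym ([≔]-same Φ d Ψ)) (coprimeℚ-sym (Ψ-coprime k rk′))
    ... | inj₂ rk′  | inj₂ rj′  = subst₂ Coprimeℚ (sym (Φ′-below k rk′)) (sym (Φ′-below j rj′))
                                    (pairwiseCoprime k j rk′ rj′ k≢j)

cyclotomicStage : ∀ D → Σ (ℕ → Poly) λ Φ → CyclotomicUpTo Φ D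
cyclotomicStage zero    = (λ _ → oneₚ) , record
  { prodPow-divisors = λ _ (1≤d , d≤0) → ⊥-elim (ℕP.<⇒≱ 1≤d d≤0)
  ; unitConst        = λ _ (1≤k , k≤0) → ⊥-elim (ℕP.<⇒≱ 1≤k k≤0)
  ; pairwiseCoprime  = λ _ _ (1≤k , k≤0) → ⊥-elim (ℕP.<⇒≱ 1≤k k≤0)
  }
cyclotomicStage (suc D) = CyclotomicStep.Φ′ Φ D cyc , CyclotomicStep.cyclotomicUpTo Φ D cyc
  where
  Φ = proj₁ (cyclotomicStage D)
  cyc = proj₂ (cyclotomicStage D)

cyclotomic : ℕ → Poly
cyclotomic k = proj₁ (cyclotomicStage k) k

cyclotomicStage-stable : ∀ D k → k ∈[1, D ] → proj₁ (cyclotomicStage D) k ≡ cyclotomic k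
cyclotomicStage-stable zero    k (1≤k , k≤0) = ⊥-elim (ℕP.<⇒≱ 1≤k k≤0)
cyclotomicStage-stable (suc D) k r with ∈[1,suc]-split r
... | inj₁ refl = refl
... | inj₂ r′   = trans ([≔]-other _ (suc D) _ k (∈[1,]-below-top r′)) (cyclotomicStage-stable D k r′)

prodPow-cyclotomic : ∀ D d → d ∈[1, D ] → prodPow cyclotomic D [_∣ d ] ≈ x^ d −1
prodPow-cyclotomic D d r = ≈-trans (prodPow-congˡ D [_∣ d ] λ k s → sym (cyclotomicStage-stable D k s))
  (CyclotomicUpTo.prodPow-divisors (proj₂ (cyclotomicStage D)) d r)

unitConst-cyclotomic : ∀ k → 1 ≤ k → UnitConst (cyclotomic k)
unitConst-cyclotomic k 1≤k = CyclotomicUpTo.unitConst (proj₂ (cyclotomicStage k)) k (1≤k , ℕP.≤-refl)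

coprimeℚ-cyclotomic : ∀ k j → 1 ≤ k → 1 ≤ j → k ≢ j → Coprimeℚ (cyclotomic k) (cyclotomic j)
coprimeℚ-cyclotomic k j 1≤k 1≤j k≢j =
  subst₂ Coprimeℚ (cyclotomicStage-stable (k + j) k rk) (cyclotomicStage-stable (k + j) j rj)
  (CyclotomicUpTo.pairwiseCoprime (proj₂ (cyclotomicStage (k + j))) k j rk rj k≢j)
  where
  rk = 1≤k , ℕP.m≤m+n k j
  rj = 1≤j , ℕP.m≤n+m j k

-- Parity, 2-adic valuation and odd multiples

data EvenOdd : ℕ → Set where
  even : ∀ t → EvenOdd (t + t)
  odd  : ∀ t → EvenOdd (suc (t + t))

evenOdd : ∀ n → EvenOdd n
evenOdd zero = even 0
evenOdd (suc n) with evenOdd n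
... | even t = odd t
... | odd  t = subst (λ m → EvenOdd (suc m)) (ℕP.+-suc t t) (even (suc t))

half-< : ∀ t → 1 ≤ t → t < t + t
half-< (suc t) _ = s≤s (ℕP.m≤n+m (suc t) t)

1≤half : ∀ t → 1 ≤ t + t → 1 ≤ t
1≤half (suc t) _ = s≤s z≤n

double≡*2 : ∀ t → t + t ≡ t * 2
double≡*2 = ℕ-Solver.solve-∀

double≡2* : ∀ t → t + t ≡ 2 * t
double≡2* = ℕ-Solver.solve-∀

parity-even : ∀ t → parity (t + t) ≡ 0ℙ
parity-even zero    = refl
parity-even (suc t) rewrite ℕP.+-suc t t = parity-even t

parity-odd : ∀ t → parity (suc (t + t)) ≡ 1ℙ
parity-odd zero    = refl
parity-odd (suc t) rewrite ℕP.+-suc t t = parity-odd t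

2∤odd : ∀ t → ¬ 2 ∣ suc (t + t)
2∤odd t (divides q 1+2t≡q*2) = 1ℙ≢0ℙ (begin
  1ℙ                      ≡⟨ parity-odd t ⟨
  parity (suc (t + t))    ≡⟨ cong parity 1+2t≡q*2 ⟩
  parity (q * 2)          ≡⟨ cong parity (double≡*2 q) ⟨
  parity (q + q)          ≡⟨ parity-even q ⟩
  0ℙ                      ∎)
  where
  open ≡-Reasoning
  1ℙ≢0ℙ : 1ℙ ≢ 0ℙ
  1ℙ≢0ℙ ()

⌊double/2⌋ : ∀ t → ⌊ t + t /2⌋ ≡ t
⌊double/2⌋ t = sym (ℕP.n≡⌊n+n/2⌋ t)

odd-coprime-2 : ∀ t → Coprime (suc (t + t)) 2
odd-coprime-2 t {d} (d∣odd , d∣2) with d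
... | zero              = ⊥-elim (ℕP.0≢1+n (sym (0∣⇒≡0 d∣2)))
... | suc zero          = refl
... | suc (suc zero)    = ⊥-elim (2∤odd t d∣odd)
... | suc (suc (suc _)) = ⊥-elim (ℕP.<⇒≱ (s≤s (s≤s (s≤s z≤n))) (∣⇒≤ d∣2))

odd∣double⇒∣ : ∀ t i → suc (t + t) ∣ i + i → suc (t + t) ∣ i
odd∣double⇒∣ t i h = coprime-divisor (odd-coprime-2 t) (subst (suc (t + t) ∣_) (trans (double≡*2 i) (ℕP.*-comm i 2)) h)

val₂-aux-fuel : ∀ f g m → m ≤ f → m ≤ g → val₂-aux f m ≡ val₂-aux g m
val₂-aux-fuel zero    zero    m       _ _ = refl
val₂-aux-fuel zero    (suc g) .zero   z≤n _ = refl
val₂-aux-fuel (suc f) zero    .zero   _ z≤n = refl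
val₂-aux-fuel (suc f) (suc g) zero    _ _ = refl
val₂-aux-fuel (suc f) (suc g) (suc m) (s≤s m≤f) (s≤s m≤g) with 2 ∣? suc m
... | yes _ = cong suc (val₂-aux-fuel f g (suc m / 2) (ℕP.≤-trans half≤m m≤f) (ℕP.≤-trans half≤m m≤g))
  where
  half≤m : suc m / 2 ≤ m
  half≤m = ℕP.≤-pred (m/n<m (suc m) 2 (s≤s (s≤s z≤n)))
... | no  _ = refl

val₂-odd : ∀ t → val₂ (suc (t + t)) ≡ 0
val₂-odd t with 2 ∣? suc (t + t)
... | yes 2∣odd = ⊥-elim (2∤odd t 2∣odd)
... | no  _     = refl

val₂-even : ∀ t → 1 ≤ t → val₂ (t + t) ≡ suc (val₂ t)
val₂-even (suc t) _ with 2 ∣? (suc t + suc t)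
... | no  2∤even = ⊥-elim (2∤even (divides (suc t) (double≡*2 (suc t))))
... | yes _      = cong suc (trans (cong (val₂-aux (t + suc t)) halve)
                                   (val₂-aux-fuel (t + suc t) (suc t) (suc t) (ℕP.m≤n+m (suc t) t) ℕP.≤-refl))
  where
  halve : (suc t + suc t) / 2 ≡ suc t
  halve = trans (cong (_/ 2) (double≡*2 (suc t))) (m*n/n≡m (suc t) 2)

val₂-odd-* : ∀ s b → 1 ≤ b → val₂ (suc (s + s) * b) ≡ val₂ b
val₂-odd-* s = <-rec (λ b → 1 ≤ b → val₂ (suc (s + s) * b) ≡ val₂ b) step
  where
  step : ∀ b → (∀ {t} → t < b → 1 ≤ t → val₂ (suc (s + s) * t) ≡ val₂ t) → 1 ≤ b → val₂ (suc (s + s) * b) ≡ val₂ b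
  step b IH 1≤b with evenOdd b
  ... | odd t = trans (cong val₂ (odd*odd s t)) (trans (val₂-odd (s + t + 2 * (s * t))) (sym (val₂-odd t)))
    where
    odd*odd : ∀ s t → suc (s + s) * suc (t + t) ≡ suc ((s + t + 2 * (s * t)) + (s + t + 2 * (s * t)))
    odd*odd = ℕ-Solver.solve-∀
  ... | even t = begin
    val₂ (suc (s + s) * (t + t))               ≡⟨ cong val₂ (ℕP.*-distribˡ-+ (suc (s + s)) t t) ⟩
    val₂ (suc (s + s) * t + suc (s + s) * t)   ≡⟨ val₂-even (suc (s + s) * t) (ℕP.*-mono-≤ {1} {suc (s + s)} (s≤s z≤n) 1≤t) ⟩
    suc (val₂ (suc (s + s) * t))               ≡⟨ cong suc (IH (half-< t 1≤t) 1≤t) ⟩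
    suc (val₂ t)                               ≡⟨ val₂-even t 1≤t ⟨
    val₂ (t + t)                               ∎
    where
    open ≡-Reasoning
    1≤t = 1≤half t 1≤b

val₂-* : ∀ a b → 1 ≤ a → 1 ≤ b → val₂ (a * b) ≡ val₂ a + val₂ b
val₂-* a b 1≤a 1≤b = <-rec (λ a → 1 ≤ a → val₂ (a * b) ≡ val₂ a + val₂ b) step a 1≤a
  where
  step : ∀ a → (∀ {t} → t < a → 1 ≤ t → val₂ (t * b) ≡ val₂ t + val₂ b) → 1 ≤ a → val₂ (a * b) ≡ val₂ a + val₂ b
  step a IH 1≤a with evenOdd a
  ... | odd s  = trans (val₂-odd-* s b 1≤b) (cong (_+ val₂ b) (sym (val₂-odd s)))
  ... | even t = begin
    val₂ ((t + t) * b)          ≡⟨ cong val₂ (ℕP.*-distribʳ-+ b t t) ⟩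
    val₂ (t * b + t * b)        ≡⟨ val₂-even (t * b) (ℕP.*-mono-≤ 1≤t 1≤b) ⟩
    suc (val₂ (t * b))          ≡⟨ cong suc (IH (half-< t 1≤t) 1≤t) ⟩
    suc (val₂ t + val₂ b)       ≡⟨ cong (_+ val₂ b) (val₂-even t 1≤t) ⟨
    val₂ (t + t) + val₂ b       ∎
    where
    open ≡-Reasoning
    1≤t = 1≤half t 1≤a

sumFrom1-val₂ : ∀ n → sumFrom1 n val₂ ≡ val₂ (n !)
sumFrom1-val₂ zero    = refl
sumFrom1-val₂ (suc n) = begin
  sumFrom1 n val₂ + val₂ (suc n)   ≡⟨ cong (_+ val₂ (suc n)) (sumFrom1-val₂ n) ⟩
  val₂ (n !) + val₂ (suc n)        ≡⟨ ℕP.+-comm (val₂ (n !)) (val₂ (suc n)) ⟩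
  val₂ (suc n) + val₂ (n !)        ≡⟨ val₂-* (suc n) (n !) (s≤s z≤n) (ℕ.>-nonZero⁻¹ (n !) {{ℕP._!≢0 n}}) ⟨
  val₂ (suc n * n !)               ∎
  where open ≡-Reasoning

double-∣-double⇔ : ∀ e m → (e + e ∣ m + m → e ∣ m) × (e ∣ m → e + e ∣ m + m)
double-∣-double⇔ e m = (λ h → *-cancelˡ-∣ 2 (subst₂ _∣_ (double≡2* e) (double≡2* m) h))
                     , (λ h → subst₂ _∣_ (sym (double≡2* e)) (sym (double≡2* m)) (*-monoʳ-∣ 2 h))

[+∣+] : ∀ e m → [ e + e ∣ m + m ] ≡ [ e ∣ m ]
[+∣+] e m with e ∣? m
... | yes e∣m = [∣]-yes (proj₂ (double-∣-double⇔ e m) e∣m)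
... | no  e∤m = [∣]-no (λ h → e∤m (proj₁ (double-∣-double⇔ e m) h))

[∣]-double : ∀ e m → [ e ∣ m ] ≤ [ e ∣ m + m ]
[∣]-double e m with e ∣? m
... | no  _   = z≤n
... | yes e∣m = ℕP.≤-reflexive (sym ([∣]-yes (∣m∣n⇒∣m+n e∣m e∣m)))

-- The multiplicity of Φ_k in 1 + x^i = (x^(2i) − 1) / (x^i − 1).
ordΦ : ℕ → ℕ → ℕ
ordΦ k i = [ k ∣ i + i ] ∸ [ k ∣ i ]

ordΦ≤1 : ∀ k i → ordΦ k i ≤ 1
ordΦ≤1 k i = ℕP.≤-trans (ℕP.m∸n≤m [ k ∣ i + i ] [ k ∣ i ]) ([∣]≤1 k (i + i))

ordΦ-odd : ∀ t i → ordΦ (suc (t + t)) i ≡ 0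
ordΦ-odd t i with suc (t + t) ∣? (i + i)
... | no  _ = ℕP.0∸n≡0 [ suc (t + t) ∣ i ]
... | yes h = cong (1 ∸_) ([∣]-yes (odd∣double⇒∣ t i h))

-- [ e ∣ₒ i ] is 1 exactly when i is an odd multiple of e.
[_∣ₒ_] : ℕ → ℕ → ℕ
[ e ∣ₒ i ] = ordΦ (e + e) i

[∣ₒ]≡ : ∀ e i → [ e ∣ₒ i ] ≡ [ e ∣ i ] ∸ [ e + e ∣ i ]
[∣ₒ]≡ e i = cong (_∸ [ e + e ∣ i ]) ([+∣+] e i)

[∣ₒ]≤1 : ∀ e i → [ e ∣ₒ i ] ≤ 1
[∣ₒ]≤1 e = ordΦ≤1 (e + e)

1≤[∣ₒ]⇒∣ : ∀ e i → 1 ≤ [ e ∣ₒ i ] → e ∣ i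
1≤[∣ₒ]⇒∣ e i h = 1≤[∣]⇒∣ (ℕP.≤-trans h (ℕP.≤-trans (ℕP.≤-reflexive ([∣ₒ]≡ e i)) (ℕP.m∸n≤m [ e ∣ i ] [ e + e ∣ i ])))

[∣ₒ]-odd : ∀ e t → [ e ∣ₒ suc (t + t) ] ≡ [ e ∣ suc (t + t) ]
[∣ₒ]-odd e t = trans ([∣ₒ]≡ e (suc (t + t))) (cong ([ e ∣ suc (t + t) ] ∸_) ([∣]-no 2e∤odd))
  where
  2e∤odd : ¬ e + e ∣ suc (t + t)
  2e∤odd h = 2∤odd t (∣-trans (divides e (double≡*2 e)) h)

[∣ₒ]-even : ∀ e t → [ e ∣ₒ t + t ] + [ e ∣ t ] ≡ [ e ∣ t + t ]
[∣ₒ]-even e t = begin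
  [ e ∣ₒ t + t ] + [ e ∣ t ]                     ≡⟨ cong (_+ [ e ∣ t ]) ([∣ₒ]≡ e (t + t)) ⟩
  ([ e ∣ t + t ] ∸ [ e + e ∣ t + t ]) + [ e ∣ t ] ≡⟨ cong (λ z → ([ e ∣ t + t ] ∸ z) + [ e ∣ t ]) ([+∣+] e t) ⟩
  ([ e ∣ t + t ] ∸ [ e ∣ t ]) + [ e ∣ t ]         ≡⟨ ℕP.m∸n+n≡m ([∣]-double e t) ⟩
  [ e ∣ t + t ]                                   ∎
  where open ≡-Reasoning

[∣ₒ]-refl : ∀ e → 1 ≤ e → [ e ∣ₒ e ] ≡ 1
[∣ₒ]-refl e 1≤e = trans ([∣ₒ]≡ e e) (cong₂ _∸_ ([∣]-yes (∣-refl {e})) ([∣]-no 2e∤e))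
  where
  2e∤e : ¬ e + e ∣ e
  2e∤e h = ℕP.<⇒≱ (half-< e 1≤e) (∣⇒≤ {{ℕ.>-nonZero 1≤e}} h)

-- Total division, with the junk value ⌊ n / 0 ⌋ = 0.
⌊_/_⌋ : ℕ → ℕ → ℕ
⌊ n / zero  ⌋ = 0
⌊ n / suc e ⌋ = n / suc e

/-suc : ∀ e m → suc m / suc e ≡ m / suc e + [ suc e ∣ suc m ]
/-suc e m with m % suc e | m≡m%n+[m/n]*n m (suc e) | m%n<n m (suc e)
... | r | m≡r+qd | r<d with suc r ℕ.≟ suc e
... | yes r+1≡d = begin
  suc m / suc e                  ≡⟨ cong (_/ suc e) 1+m≡[1+q]d ⟩
  suc (m / suc e) * suc e / suc e ≡⟨ m*n/n≡m (suc (m / suc e)) (suc e) ⟩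
  suc (m / suc e)                ≡⟨ ℕP.+-comm 1 (m / suc e) ⟩
  m / suc e + 1                  ≡⟨ cong (_+_ (m / suc e)) ([∣]-yes (divides (suc (m / suc e)) 1+m≡[1+q]d)) ⟨
  m / suc e + [ suc e ∣ suc m ]  ∎
  where
  open ≡-Reasoning
  1+m≡[1+q]d : suc m ≡ suc (m / suc e) * suc e
  1+m≡[1+q]d = trans (cong suc m≡r+qd) (cong (_+ (m / suc e) * suc e) r+1≡d)
... | no  r+1≢d = begin
  suc m / suc e                         ≡⟨ cong (λ z → suc z / suc e) m≡r+qd ⟩
  (suc r + (m / suc e) * suc e) / suc e ≡⟨ +-distrib-/ (suc r) ((m / suc e) * suc e) (subst (_< suc e) (sym remainders) r+1<d) ⟩
  suc r / suc e + (m / suc e) * suc e / suc e ≡⟨ cong₂ _+_ (m<n⇒m/n≡0 r+1<d) (m*n/n≡m (m / suc e) (suc e)) ⟩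
  m / suc e                             ≡⟨ ℕP.+-identityʳ (m / suc e) ⟨
  m / suc e + 0                         ≡⟨ cong (_+_ (m / suc e)) ([∣]-no d∤1+m) ⟨
  m / suc e + [ suc e ∣ suc m ]         ∎
  where
  open ≡-Reasoning
  r+1<d : suc r < suc e
  r+1<d = ℕP.≤∧≢⇒< r<d r+1≢d
  remainders : suc r % suc e + (m / suc e) * suc e % suc e ≡ suc r
  remainders = trans (cong₂ _+_ (m<n⇒m%n≡m r+1<d) (m*n%n≡0 (m / suc e) (suc e))) (ℕP.+-identityʳ (suc r))
  d∤1+m : ¬ suc e ∣ suc m
  d∤1+m h = ℕP.0≢1+n (begin
    0                                   ≡⟨ n∣m⇒m%n≡0 (suc m) (suc e) h ⟨
    suc m % suc e                       ≡⟨ cong (λ z → suc z % suc e) m≡r+qd ⟩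
    (suc r + (m / suc e) * suc e) % suc e ≡⟨ [m+kn]%n≡m%n (suc r) (m / suc e) (suc e) ⟩
    suc r % suc e                       ≡⟨ m<n⇒m%n≡m r+1<d ⟩
    suc r                               ∎)

sumFrom1-[∣] : ∀ e n → sumFrom1 n [ suc e ∣_] ≡ n / suc e
sumFrom1-[∣] e zero    = refl
sumFrom1-[∣] e (suc n) = trans (cong (_+ [ suc e ∣ suc n ]) (sumFrom1-[∣] e n)) (sym (/-suc e n))

-- Dyadic chains i, 2i, 4i, …

-- With fuel f > j, this is 1 if j = i · 2^s for some s and 0 otherwise.
≼₂-fuel : ℕ → ℕ → ℕ → ℕ
≼₂-fuel zero    i j = δ j i
≼₂-fuel (suc f) i j with parity j | ⌊ j /2⌋
... | 0ℙ | suc h = δ j i + ≼₂-fuel f i (suc h)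
... | _  | _     = δ j i

[_≼₂_] : ℕ → ℕ → ℕ
[ i ≼₂ j ] = ≼₂-fuel (suc j) i j

⌊/2⌋<-self : ∀ j → 1 ≤ ⌊ j /2⌋ → ⌊ j /2⌋ < j
⌊/2⌋<-self (suc j) _ = ℕP.⌊n/2⌋<n j

≼₂-fuel-irrelevant : ∀ f g i j → j < f → j < g → ≼₂-fuel f i j ≡ ≼₂-fuel g i j
≼₂-fuel-irrelevant (suc f) (suc g) i j (s≤s j≤f) (s≤s j≤g) with parity j | ⌊ j /2⌋ in half≡
... | 0ℙ | suc h = cong (_+_ (δ j i)) (≼₂-fuel-irrelevant f g i (suc h) (ℕP.<-≤-trans h<j j≤f) (ℕP.<-≤-trans h<j j≤g))
  where
  h<j : suc h < j
  h<j = subst (_< j) half≡ (⌊/2⌋<-self j (subst (1 ≤_) (sym half≡) (s≤s z≤n)))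
... | 0ℙ | zero  = refl
... | 1ℙ | _     = refl

≼₂-odd : ∀ t i → [ i ≼₂ suc (t + t) ] ≡ δ (suc (t + t)) i
≼₂-odd t i rewrite parity-odd t = refl

≼₂-even : ∀ t i → 1 ≤ t → [ i ≼₂ t + t ] ≡ δ (t + t) i + [ i ≼₂ t ]
≼₂-even (suc t) i _ rewrite parity-even (suc t) | ⌊double/2⌋ (suc t) =
  cong (_+_ (δ (suc t + suc t) i))
       (≼₂-fuel-irrelevant (suc (t + suc t)) (suc (suc t)) i (suc t) (s≤s (ℕP.m≤n+m (suc t) t)) ℕP.≤-refl)

≼₂-≤-[∣] : ∀ i j → 1 ≤ j → [ i ≼₂ j ] ≤ [ i ∣ j ]
≼₂-≤-[∣] i = <-rec (λ j → 1 ≤ j → [ i ≼₂ j ] ≤ [ i ∣ j ]) step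
  where
  step : ∀ j → (∀ {t} → t < j → 1 ≤ t → [ i ≼₂ t ] ≤ [ i ∣ t ]) → 1 ≤ j → [ i ≼₂ j ] ≤ [ i ∣ j ]
  step j IH 1≤j with evenOdd j
  ... | odd t with i ℕ.≟ suc (t + t)
  ...   | yes refl = ℕP.≤-reflexive (trans (≼₂-odd t i) (trans (δ-refl i) (sym ([∣]-yes (∣-refl {i})))))
  ...   | no  i≢j  = ℕP.≤-trans (ℕP.≤-reflexive (trans (≼₂-odd t i) (δ-≢ (suc (t + t)) i i≢j))) z≤n
  step j IH 1≤j | even t with i ℕ.≟ t + t
  ...   | yes refl = ℕP.≤-reflexive (begin
    [ i ≼₂ t + t ]
      ≡⟨ ≼₂-even t i 1≤t ⟩
    δ (t + t) (t + t) + [ i ≼₂ t ]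
      ≡⟨ cong₂ _+_ (δ-refl (t + t)) (ℕP.n≤0⇒n≡0 (ℕP.≤-trans (IH (half-< t 1≤t) 1≤t) (ℕP.≤-reflexive ([∣]-no 2t∤t)))) ⟩
    1
      ≡⟨ [∣]-yes (∣-refl {t + t}) ⟨
    [ t + t ∣ t + t ] ∎)
    where
    open ≡-Reasoning
    1≤t = 1≤half t 1≤j
    2t∤t : ¬ (t + t ∣ t)
    2t∤t h = ℕP.<⇒≱ (half-< t 1≤t) (∣⇒≤ {{ℕ.>-nonZero 1≤t}} h)
  ...   | no  i≢j  = begin
    [ i ≼₂ t + t ]            ≡⟨ ≼₂-even t i 1≤t ⟩
    δ (t + t) i + [ i ≼₂ t ]  ≡⟨ cong (_+ [ i ≼₂ t ]) (δ-≢ (t + t) i i≢j) ⟩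
    [ i ≼₂ t ]                ≤⟨ IH (half-< t 1≤t) 1≤t ⟩
    [ i ∣ t ]                 ≤⟨ [∣]-double i t ⟩
    [ i ∣ t + t ]             ∎
    where
    open ℕP.≤-Reasoning
    1≤t = 1≤half t 1≤j

∈[1,]-half : ∀ {n t} → t + t ∈[1, n ] → t ∈[1, n ]
∈[1,]-half {n} {t} (1≤2t , 2t≤n) = 1≤half t 1≤2t , ℕP.≤-trans (ℕP.m≤m+n t t) 2t≤n

sumFrom1-δ-const : ∀ n j → j ∈[1, n ] → sumFrom1 n (δ j) ≡ 1
sumFrom1-δ-const n j r = trans (sumFrom1-cong n λ i _ → sym (ℕP.*-identityʳ (δ j i))) (sumFrom1-δ n (λ _ → 1) j r)

-- Every j is i · 2^s for exactly one odd multiple i of e, when e ∣ j, and for none otherwise.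
sumFrom1-≼₂-[∣ₒ] : ∀ n e j → j ∈[1, n ] → sumFrom1 n (λ i → [ i ≼₂ j ] * [ e ∣ₒ i ]) ≡ [ e ∣ j ]
sumFrom1-≼₂-[∣ₒ] n e = <-rec (λ j → j ∈[1, n ] → sumFrom1 n (λ i → [ i ≼₂ j ] * [ e ∣ₒ i ]) ≡ [ e ∣ j ]) step
  where
  step : ∀ j → (∀ {t} → t < j → t ∈[1, n ] → sumFrom1 n (λ i → [ i ≼₂ t ] * [ e ∣ₒ i ]) ≡ [ e ∣ t ]) →
         j ∈[1, n ] → sumFrom1 n (λ i → [ i ≼₂ j ] * [ e ∣ₒ i ]) ≡ [ e ∣ j ]
  step j IH r with evenOdd j
  ... | odd t = begin
    sumFrom1 n (λ i → [ i ≼₂ suc (t + t) ] * [ e ∣ₒ i ])   ≡⟨ sumFrom1-cong n (λ i _ → cong (_* [ e ∣ₒ i ]) (≼₂-odd t i)) ⟩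
    sumFrom1 n (λ i → δ (suc (t + t)) i * [ e ∣ₒ i ])      ≡⟨ sumFrom1-δ n [ e ∣ₒ_] (suc (t + t)) r ⟩
    [ e ∣ₒ suc (t + t) ]                                   ≡⟨ [∣ₒ]-odd e t ⟩
    [ e ∣ suc (t + t) ]                                    ∎
    where open ≡-Reasoning
  ... | even t = begin
    sumFrom1 n (λ i → [ i ≼₂ t + t ] * [ e ∣ₒ i ])
      ≡⟨ sumFrom1-cong n (λ i _ → split i) ⟩
    sumFrom1 n (λ i → δ (t + t) i * [ e ∣ₒ i ] + [ i ≼₂ t ] * [ e ∣ₒ i ])
      ≡⟨ sumFrom1-distrib-+ n _ _ ⟩
    sumFrom1 n (λ i → δ (t + t) i * [ e ∣ₒ i ]) + sumFrom1 n (λ i → [ i ≼₂ t ] * [ e ∣ₒ i ])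
      ≡⟨ cong₂ _+_ (sumFrom1-δ n [ e ∣ₒ_] (t + t) r) (IH (half-< t 1≤t) (∈[1,]-half r)) ⟩
    [ e ∣ₒ t + t ] + [ e ∣ t ]
      ≡⟨ [∣ₒ]-even e t ⟩
    [ e ∣ t + t ] ∎
    where
    open ≡-Reasoning
    1≤t = 1≤half t (proj₁ r)
    split : ∀ i → [ i ≼₂ t + t ] * [ e ∣ₒ i ] ≡ δ (t + t) i * [ e ∣ₒ i ] + [ i ≼₂ t ] * [ e ∣ₒ i ]
    split i = trans (cong (_* [ e ∣ₒ i ]) (≼₂-even t i 1≤t)) (ℕP.*-distribʳ-+ [ e ∣ₒ i ] (δ (t + t) i) [ i ≼₂ t ])

-- j = (odd part) · 2^s for s = 0, …, val₂ j.
sumFrom1-≼₂ : ∀ n j → j ∈[1, n ] → sumFrom1 n [_≼₂ j ] ≡ suc (val₂ j)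
sumFrom1-≼₂ n = <-rec (λ j → j ∈[1, n ] → sumFrom1 n [_≼₂ j ] ≡ suc (val₂ j)) step
  where
  step : ∀ j → (∀ {t} → t < j → t ∈[1, n ] → sumFrom1 n [_≼₂ t ] ≡ suc (val₂ t)) →
         j ∈[1, n ] → sumFrom1 n [_≼₂ j ] ≡ suc (val₂ j)
  step j IH r with evenOdd j
  ... | odd t = begin
    sumFrom1 n [_≼₂ suc (t + t) ]   ≡⟨ sumFrom1-cong n (λ i _ → ≼₂-odd t i) ⟩
    sumFrom1 n (δ (suc (t + t)))    ≡⟨ sumFrom1-δ-const n (suc (t + t)) r ⟩
    1                               ≡⟨ cong suc (val₂-odd t) ⟨
    suc (val₂ (suc (t + t)))        ∎
    where open ≡-Reasoning
  ... | even t = begin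
    sumFrom1 n [_≼₂ t + t ]                          ≡⟨ sumFrom1-cong n (λ i _ → ≼₂-even t i 1≤t) ⟩
    sumFrom1 n (λ i → δ (t + t) i + [ i ≼₂ t ])      ≡⟨ sumFrom1-distrib-+ n (δ (t + t)) [_≼₂ t ] ⟩
    sumFrom1 n (δ (t + t)) + sumFrom1 n [_≼₂ t ]     ≡⟨ cong₂ _+_ (sumFrom1-δ-const n (t + t) r) (IH (half-< t 1≤t) (∈[1,]-half r)) ⟩
    suc (suc (val₂ t))                               ≡⟨ cong suc (val₂-even t 1≤t) ⟨
    suc (val₂ (t + t))                               ∎
    where
    open ≡-Reasoning
    1≤t = 1≤half t (proj₁ r)

-- The number of terms of i, 2i, 4i, … that do not exceed n.
doublings : ℕ → ℕ → ℕ
doublings n i = sumFrom1 n [ i ≼₂_]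

doublings≤⌊/⌋ : ∀ n i → 1 ≤ i → doublings n i ≤ ⌊ n / i ⌋
doublings≤⌊/⌋ n (suc i) _ = begin
  sumFrom1 n [ suc i ≼₂_]   ≤⟨ sumFrom1-mono-≤ n (λ j r → ≼₂-≤-[∣] (suc i) j (proj₁ r)) ⟩
  sumFrom1 n [ suc i ∣_]    ≡⟨ sumFrom1-[∣] i n ⟩
  n / suc i                 ∎
  where open ℕP.≤-Reasoning

sumFrom1-doublings : ∀ n → sumFrom1 n (doublings n) ≡ n + val₂ (n !)
sumFrom1-doublings n = begin
  sumFrom1 n (λ i → sumFrom1 n [ i ≼₂_])   ≡⟨ sumFrom1-swap n n [_≼₂_] ⟩
  sumFrom1 n (λ j → sumFrom1 n [_≼₂ j ])   ≡⟨ sumFrom1-cong n (sumFrom1-≼₂ n) ⟩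
  sumFrom1 n (λ j → 1 + val₂ j)            ≡⟨ sumFrom1-distrib-+ n (λ _ → 1) val₂ ⟩
  sumFrom1 n (λ _ → 1) + sumFrom1 n val₂   ≡⟨ cong₂ _+_ (trans (sumFrom1-const n 1) (ℕP.*-identityʳ n)) (sumFrom1-val₂ n) ⟩
  n + val₂ (n !)                           ∎
  where open ≡-Reasoning

sumFrom1-doublings-[∣ₒ] : ∀ n e → sumFrom1 n (λ i → doublings n i * [ suc e ∣ₒ i ]) ≡ n / suc e
sumFrom1-doublings-[∣ₒ] n e = begin
  sumFrom1 n (λ i → doublings n i * [ suc e ∣ₒ i ])
    ≡⟨ sumFrom1-cong n (λ i _ → sumFrom1-*ʳ n [ i ≼₂_] [ suc e ∣ₒ i ]) ⟩
  sumFrom1 n (λ i → sumFrom1 n (λ j → [ i ≼₂ j ] * [ suc e ∣ₒ i ]))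
    ≡⟨ sumFrom1-swap n n (λ i j → [ i ≼₂ j ] * [ suc e ∣ₒ i ]) ⟩
  sumFrom1 n (λ j → sumFrom1 n (λ i → [ i ≼₂ j ] * [ suc e ∣ₒ i ]))
    ≡⟨ sumFrom1-cong n (sumFrom1-≼₂-[∣ₒ] n (suc e)) ⟩
  sumFrom1 n [ suc e ∣_]
    ≡⟨ sumFrom1-[∣] e n ⟩
  n / suc e ∎
  where open ≡-Reasoning

-- Partitions

mult-∷ : ∀ p xs i → mult (p ∷ xs) i ≡ δ i p + mult xs i
mult-∷ p xs i with p ℕ.≟ i
... | yes refl = cong length (ListP.filter-accept (ℕ._≟ p) refl)
... | no  p≢i  = cong length (ListP.filter-reject (ℕ._≟ i) p≢i)

mult-++ : ∀ xs ys i → mult (xs ++ ys) i ≡ mult xs i + mult ys i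
mult-++ []       ys i = refl
mult-++ (p ∷ xs) ys i = begin
  mult (p ∷ xs ++ ys) i               ≡⟨ mult-∷ p (xs ++ ys) i ⟩
  δ i p + mult (xs ++ ys) i           ≡⟨ cong (_+_ (δ i p)) (mult-++ xs ys i) ⟩
  δ i p + (mult xs i + mult ys i)     ≡⟨ ℕP.+-assoc (δ i p) _ _ ⟨
  (δ i p + mult xs i) + mult ys i     ≡⟨ cong (_+ mult ys i) (mult-∷ p xs i) ⟨
  mult (p ∷ xs) i + mult ys i         ∎
  where open ≡-Reasoning

mult-replicate : ∀ c p i → mult (replicate c p) i ≡ c * δ i p
mult-replicate zero    p i = refl
mult-replicate (suc c) p i = trans (mult-∷ p (replicate c p) i) (cong (_+_ (δ i p)) (mult-replicate c p i))

sumFrom1-mult-[∣ₒ]-≤ : ∀ n e xs → sumFrom1 n (λ i → mult xs i * [ e ∣ₒ i ]) ≤ sum (map [ e ∣ₒ_] xs)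
sumFrom1-mult-[∣ₒ]-≤ n e []       = ℕP.≤-reflexive (sumFrom1-zero n λ _ _ → refl)
sumFrom1-mult-[∣ₒ]-≤ n e (p ∷ xs) = begin
  sumFrom1 n (λ i → mult (p ∷ xs) i * [ e ∣ₒ i ])
    ≡⟨ sumFrom1-cong n (λ i _ → split i) ⟩
  sumFrom1 n (λ i → δ p i * [ e ∣ₒ i ] + mult xs i * [ e ∣ₒ i ])
    ≡⟨ sumFrom1-distrib-+ n _ _ ⟩
  sumFrom1 n (λ i → δ p i * [ e ∣ₒ i ]) + sumFrom1 n (λ i → mult xs i * [ e ∣ₒ i ])
    ≤⟨ ℕP.+-mono-≤ (sumFrom1-δ-≤ n [ e ∣ₒ_] p) (sumFrom1-mult-[∣ₒ]-≤ n e xs) ⟩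
  [ e ∣ₒ p ] + sum (map [ e ∣ₒ_] xs) ∎
  where
  open ℕP.≤-Reasoning
  split : ∀ i → mult (p ∷ xs) i * [ e ∣ₒ i ] ≡ δ p i * [ e ∣ₒ i ] + mult xs i * [ e ∣ₒ i ]
  split i = trans (cong (_* [ e ∣ₒ i ]) (trans (mult-∷ p xs i) (cong (_+ mult xs i) (δ-sym i p))))
                  (ℕP.*-distribʳ-+ [ e ∣ₒ i ] (δ p i) (mult xs i))

-- Each part that is an odd multiple of e is at least e.
sum-map-[∣ₒ]-*-≤ : ∀ e xs → All (1 ≤_) xs → sum (map [ suc e ∣ₒ_] xs) * suc e ≤ sum xs
sum-map-[∣ₒ]-*-≤ e []       []          = z≤n
sum-map-[∣ₒ]-*-≤ e (p ∷ xs) (1≤p ∷ 1≤xs) = begin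
  ([ suc e ∣ₒ p ] + sum (map [ suc e ∣ₒ_] xs)) * suc e        ≡⟨ ℕP.*-distribʳ-+ (suc e) [ suc e ∣ₒ p ] _ ⟩
  [ suc e ∣ₒ p ] * suc e + sum (map [ suc e ∣ₒ_] xs) * suc e  ≤⟨ ℕP.+-mono-≤ part≤p (sum-map-[∣ₒ]-*-≤ e xs 1≤xs) ⟩
  p + sum xs                                                  ∎
  where
  open ℕP.≤-Reasoning
  part≤p : [ suc e ∣ₒ p ] * suc e ≤ p
  part≤p with [ suc e ∣ₒ p ] in eq
  ... | zero        = z≤n
  ... | suc zero    = begin
    suc e + 0  ≡⟨ ℕP.+-identityʳ (suc e) ⟩
    suc e      ≤⟨ ∣⇒≤ {{ℕ.>-nonZero 1≤p}} (1≤[∣ₒ]⇒∣ (suc e) p (ℕP.≤-reflexive (sym eq))) ⟩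
    p          ∎
  ... | suc (suc _) = ⊥-elim (ℕP.<⇒≱ (s≤s (s≤s z≤n)) (subst (_≤ 1) eq ([∣ₒ]≤1 (suc e) p)))

partition-sumFrom1-mult-[∣ₒ]-≤ : ∀ n e xs → IsPartition n xs → sumFrom1 n (λ i → mult xs i * [ suc e ∣ₒ i ]) ≤ n / suc e
partition-sumFrom1-mult-[∣ₒ]-≤ n e xs (1≤xs , _ , Σxs≡n) = begin
  sumFrom1 n (λ i → mult xs i * [ suc e ∣ₒ i ])  ≤⟨ sumFrom1-mult-[∣ₒ]-≤ n (suc e) xs ⟩
  c                                              ≡⟨ m*n/n≡m c (suc e) ⟨
  c * suc e / suc e                              ≤⟨ /-monoˡ-≤ (suc e) (ℕP.≤-trans (sum-map-[∣ₒ]-*-≤ e xs 1≤xs) (ℕP.≤-reflexive Σxs≡n)) ⟩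
  n / suc e                                      ∎
  where
  open ℕP.≤-Reasoning
  c = sum (map [ suc e ∣ₒ_] xs)

blockPartition : ℕ → ℕ → List ℕ
blockPartition n e = replicate (n / suc e) (suc e) ++ replicate (n % suc e) 1

blockPartition-isPartition : ∀ n e → IsPartition n (blockPartition n e)
blockPartition-isPartition n e = AllP.++⁺ (AllP.replicate⁺ (n / suc e) (s≤s z≤n)) (AllP.replicate⁺ (n % suc e) ℕP.≤-refl)
                               , decreasing (n / suc e) (n % suc e)
                               , Σ≡n
  where
  ones : ∀ r → Linked _≥_ (replicate r 1)
  ones zero          = []
  ones (suc zero)    = [-]
  ones (suc (suc r)) = ℕP.≤-refl ∷ ones (suc r)
  decreasing : ∀ c r → Linked _≥_ (replicate c (suc e) ++ replicate r 1)
  decreasing zero          r       = ones r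
  decreasing (suc zero)    zero    = [-]
  decreasing (suc zero)    (suc r) = s≤s z≤n ∷ ones (suc r)
  decreasing (suc (suc c)) r       = ℕP.≤-refl ∷ decreasing (suc c) r
  sum-replicate : ∀ c p → sum (replicate c p) ≡ c * p
  sum-replicate zero    p = refl
  sum-replicate (suc c) p = cong (_+_ p) (sum-replicate c p)
  Σ≡n : sum (blockPartition n e) ≡ n
  Σ≡n = begin
    sum (blockPartition n e)
      ≡⟨ sum-++ (replicate (n / suc e) (suc e)) _ ⟩
    sum (replicate (n / suc e) (suc e)) + sum (replicate (n % suc e) 1)
      ≡⟨ cong₂ _+_ (sum-replicate (n / suc e) (suc e)) (trans (sum-replicate (n % suc e) 1) (ℕP.*-identityʳ _)) ⟩
    n / suc e * suc e + n % suc e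
      ≡⟨ ℕP.+-comm _ (n % suc e) ⟩
    n % suc e + n / suc e * suc e
      ≡⟨ m≡m%n+[m/n]*n n (suc e) ⟨
    n ∎
    where open ≡-Reasoning

mult-blockPartition-[∣ₒ] : ∀ n e i → 1 ≤ [ suc e ∣ₒ i ] → mult (blockPartition n e) i ≡ δ (suc e) i * (n / suc e)
mult-blockPartition-[∣ₒ] n e i 1≤[e∣ₒi] = begin
  mult (blockPartition n e) i
    ≡⟨ mult-++ (replicate (n / suc e) (suc e)) _ i ⟩
  mult (replicate (n / suc e) (suc e)) i + mult (replicate (n % suc e) 1) i
    ≡⟨ cong₂ _+_ (mult-replicate (n / suc e) (suc e) i) (mult-replicate (n % suc e) 1 i) ⟩
  n / suc e * δ i (suc e) + n % suc e * δ i 1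
    ≡⟨ cong₂ _+_ (trans (ℕP.*-comm (n / suc e) _) (cong (_* (n / suc e)) (δ-sym i (suc e)))) no-ones ⟩
  δ (suc e) i * (n / suc e) + 0
    ≡⟨ ℕP.+-identityʳ _ ⟩
  δ (suc e) i * (n / suc e) ∎
  where
  open ≡-Reasoning
  no-ones : n % suc e * δ i 1 ≡ 0
  no-ones with i ℕ.≟ 1
  ... | no  i≢1 = trans (cong (n % suc e *_) (δ-≢ i 1 (λ 1≡i → i≢1 (sym 1≡i)))) (ℕP.*-zeroʳ (n % suc e))
  ... | yes i≡1 = cong (_* δ i 1) (remainder-zero e e+1≡1)
    where
    e+1≡1 : suc e ≡ 1
    e+1≡1 = ∣1⇒≡1 (1≤[∣ₒ]⇒∣ (suc e) 1 (subst (λ j → 1 ≤ [ suc e ∣ₒ j ]) i≡1 1≤[e∣ₒi]))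
    remainder-zero : ∀ e → suc e ≡ 1 → n % suc e ≡ 0
    remainder-zero zero _ = n%1≡0 n

sumFrom1-mult-blockPartition-[∣ₒ] : ∀ n e → suc e ≤ n →
  sumFrom1 n (λ i → mult (blockPartition n e) i * [ suc e ∣ₒ i ]) ≡ n / suc e
sumFrom1-mult-blockPartition-[∣ₒ] n e e<n =
  trans (sumFrom1-cong n λ i _ → pointwise i) (sumFrom1-δ n (λ _ → n / suc e) (suc e) (s≤s z≤n , e<n))
  where
  pointwise : ∀ i → mult (blockPartition n e) i * [ suc e ∣ₒ i ] ≡ δ (suc e) i * (n / suc e)
  pointwise i with [ suc e ∣ₒ i ] in eq
  ... | zero        = trans (ℕP.*-zeroʳ (mult (blockPartition n e) i)) (sym (cong (_* (n / suc e)) (δ-≢ (suc e) i i≢e+1)))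
    where
    i≢e+1 : i ≢ suc e
    i≢e+1 refl = ℕP.0≢1+n (trans (sym eq) ([∣ₒ]-refl (suc e) (s≤s z≤n)))
  ... | suc zero    = trans (ℕP.*-identityʳ _) (mult-blockPartition-[∣ₒ] n e i (ℕP.≤-reflexive (sym eq)))
  ... | suc (suc _) = ⊥-elim (ℕP.<⇒≱ (s≤s (s≤s z≤n)) (subst (_≤ 1) eq ([∣ₒ]≤1 (suc e) i)))

mult-blockPartition-≤ : ∀ n e i → 1 ≤ [ suc e ∣ₒ i ] → mult (blockPartition n e) i ≤ ⌊ n / i ⌋
mult-blockPartition-≤ n e i h with i ℕ.≟ suc e
... | yes refl = ℕP.≤-reflexive (begin
  mult (blockPartition n e) i   ≡⟨ mult-blockPartition-[∣ₒ] n e i h ⟩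
  δ i i * (n / i)               ≡⟨ cong (_* (n / i)) (δ-refl i) ⟩
  1 * (n / i)                   ≡⟨ ℕP.*-identityˡ (n / i) ⟩
  n / i                         ∎)
  where open ≡-Reasoning
... | no  i≢e+1 = ℕP.≤-trans (ℕP.≤-reflexive (begin
  mult (blockPartition n e) i   ≡⟨ mult-blockPartition-[∣ₒ] n e i h ⟩
  δ (suc e) i * (n / suc e)     ≡⟨ cong (_* (n / suc e)) (δ-≢ (suc e) i i≢e+1) ⟩
  0                             ∎)) z≤n
  where open ≡-Reasoning

-- Cyclotomic multiplicities of h_λ and of G

-- The multiplicity of Φ_k in ∏_{i ≤ n} (1 + x^i)^(c i).
ordΦ-∏ : ℕ → (ℕ → ℕ) → ℕ → ℕ
ordΦ-∏ n c k = sumFrom1 n (λ i → c i * ordΦ k i)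

gcdExponent : ℕ → ℕ → ℕ
gcdExponent n i = ⌊ n / i ⌋ ∸ doublings n i

hExponent : ℕ → List ℕ → ℕ → ℕ
hExponent n xs i = ⌊ n / i ⌋ ∸ mult xs i

ordΦ-∏-odd : ∀ n c t → ordΦ-∏ n c (suc (t + t)) ≡ 0
ordΦ-∏-odd n c t = sumFrom1-zero n λ i _ → trans (cong (c i *_) (ordΦ-odd t i)) (ℕP.*-zeroʳ (c i))

∸-*-+-* : ∀ a b c → b ≤ a → (a ∸ b) * c + b * c ≡ a * c
∸-*-+-* a b c b≤a = trans (sym (ℕP.*-distribʳ-+ c (a ∸ b) b)) (cong (_* c) (ℕP.m∸n+n≡m b≤a))

*-≤-∸-*-+-* : ∀ a b c → a * c ≤ (a ∸ b) * c + b * c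
*-≤-∸-*-+-* a b c = ℕP.≤-trans (ℕP.*-monoˡ-≤ c (ℕP.≤-trans (ℕP.m≤n+m∸n a b) (ℕP.≤-reflexive (ℕP.+-comm b (a ∸ b)))))
                               (ℕP.≤-reflexive (ℕP.*-distribʳ-+ c (a ∸ b) b))

-- For k = 2(e + 1), both sides are compared with Σ ⌊n/i⌋ [e + 1 ∣ₒ i] minus ⌊n/(e + 1)⌋.
module EvenExponent (n e : ℕ) where
  d = suc e

  full : ℕ
  full = sumFrom1 n (λ i → ⌊ n / i ⌋ * [ d ∣ₒ i ])

  gcd+⌊n/d⌋≡full : ordΦ-∏ n (gcdExponent n) (d + d) + n / d ≡ full
  gcd+⌊n/d⌋≡full = begin
    ordΦ-∏ n (gcdExponent n) (d + d) + n / d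
      ≡⟨ cong (_+_ (ordΦ-∏ n (gcdExponent n) (d + d))) (sumFrom1-doublings-[∣ₒ] n e) ⟨
    ordΦ-∏ n (gcdExponent n) (d + d) + sumFrom1 n (λ i → doublings n i * [ d ∣ₒ i ])
      ≡⟨ sumFrom1-distrib-+ n _ _ ⟨
    sumFrom1 n (λ i → gcdExponent n i * [ d ∣ₒ i ] + doublings n i * [ d ∣ₒ i ])
      ≡⟨ sumFrom1-cong n (λ i r → ∸-*-+-* ⌊ n / i ⌋ (doublings n i) [ d ∣ₒ i ] (doublings≤⌊/⌋ n i (proj₁ r))) ⟩
    full ∎
    where open ≡-Reasoning

  full≤h+mult : ∀ xs → full ≤ ordΦ-∏ n (hExponent n xs) (d + d) + sumFrom1 n (λ i → mult xs i * [ d ∣ₒ i ])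
  full≤h+mult xs = ℕP.≤-trans (sumFrom1-mono-≤ n λ i _ → *-≤-∸-*-+-* ⌊ n / i ⌋ (mult xs i) [ d ∣ₒ i ])
                              (ℕP.≤-reflexive (sumFrom1-distrib-+ n _ _))

  gcd≤h : ∀ xs → IsPartition n xs → ordΦ-∏ n (gcdExponent n) (d + d) ≤ ordΦ-∏ n (hExponent n xs) (d + d)
  gcd≤h xs p = ℕP.+-cancelʳ-≤ (n / d) _ _ (begin
    ordΦ-∏ n (gcdExponent n) (d + d) + n / d
      ≡⟨ gcd+⌊n/d⌋≡full ⟩
    full
      ≤⟨ full≤h+mult xs ⟩
    ordΦ-∏ n (hExponent n xs) (d + d) + sumFrom1 n (λ i → mult xs i * [ d ∣ₒ i ])
      ≤⟨ ℕP.+-monoʳ-≤ _ (partition-sumFrom1-mult-[∣ₒ]-≤ n e xs p) ⟩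
    ordΦ-∏ n (hExponent n xs) (d + d) + n / d ∎)
    where open ℕP.≤-Reasoning

  h-blockPartition≡gcd : d ≤ n → ordΦ-∏ n (hExponent n (blockPartition n e)) (d + d) ≡ ordΦ-∏ n (gcdExponent n) (d + d)
  h-blockPartition≡gcd d≤n = ℕP.+-cancelʳ-≡ (n / d) _ _ (begin
    ordΦ-∏ n (hExponent n β) (d + d) + n / d
      ≡⟨ cong (_+_ (ordΦ-∏ n (hExponent n β) (d + d))) (sumFrom1-mult-blockPartition-[∣ₒ] n e d≤n) ⟨
    ordΦ-∏ n (hExponent n β) (d + d) + sumFrom1 n (λ i → mult β i * [ d ∣ₒ i ])
      ≡⟨ sumFrom1-distrib-+ n _ _ ⟨
    sumFrom1 n (λ i → hExponent n β i * [ d ∣ₒ i ] + mult β i * [ d ∣ₒ i ])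
      ≡⟨ sumFrom1-cong n (λ i _ → pointwise i) ⟩
    full
      ≡⟨ gcd+⌊n/d⌋≡full ⟨
    ordΦ-∏ n (gcdExponent n) (d + d) + n / d ∎)
    where
    open ≡-Reasoning
    β = blockPartition n e
    pointwise : ∀ i → hExponent n β i * [ d ∣ₒ i ] + mult β i * [ d ∣ₒ i ] ≡ ⌊ n / i ⌋ * [ d ∣ₒ i ]
    pointwise i with [ d ∣ₒ i ] in eq
    ... | zero  = trans (cong₂ _+_ (ℕP.*-zeroʳ (hExponent n β i)) (ℕP.*-zeroʳ (mult β i))) (sym (ℕP.*-zeroʳ ⌊ n / i ⌋))
    ... | suc c = ∸-*-+-* ⌊ n / i ⌋ (mult β i) (suc c) (mult-blockPartition-≤ n e i (subst (1 ≤_) (sym eq) (s≤s z≤n)))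

ordΦ-∏-gcd≤h : ∀ n xs → IsPartition n xs → ∀ k → k ∈[1, n + n ] → ordΦ-∏ n (gcdExponent n) k ≤ ordΦ-∏ n (hExponent n xs) k
ordΦ-∏-gcd≤h n xs p k r with evenOdd k
... | odd t        = ℕP.≤-reflexive (trans (ordΦ-∏-odd n (gcdExponent n) t) (sym (ordΦ-∏-odd n (hExponent n xs) t)))
... | even zero    = ⊥-elim (ℕP.<⇒≱ (proj₁ r) z≤n)
... | even (suc e) = EvenExponent.gcd≤h n e xs p

ordΦ-∏-h-attains-gcd : ∀ n k → k ∈[1, n + n ] →
  ∃ λ xs → IsPartition n xs × ordΦ-∏ n (hExponent n xs) k ≤ ordΦ-∏ n (gcdExponent n) k
ordΦ-∏-h-attains-gcd n k r with evenOdd k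
... | odd t        = blockPartition n 0 , blockPartition-isPartition n 0
                   , ℕP.≤-reflexive (trans (ordΦ-∏-odd n (hExponent n (blockPartition n 0)) t)
                                           (sym (ordΦ-∏-odd n (gcdExponent n) t)))
... | even zero    = ⊥-elim (ℕP.<⇒≱ (proj₁ r) z≤n)
... | even (suc e) = blockPartition n e , blockPartition-isPartition n e
                   , ℕP.≤-reflexive (EvenExponent.h-blockPartition≡gcd n e (half≤ (proj₂ r)))
  where
  half≤ : ∀ {t} → t + t ≤ n + n → t ≤ n
  half≤ {t} h with ℕP.≤-<-connex t n
  ... | inj₁ t≤n = t≤n
  ... | inj₂ n<t = ⊥-elim (ℕP.<⇒≱ (ℕP.+-mono-< n<t n<t) h)

ordΦ-∏-h≤ : ∀ n xs k → ordΦ-∏ n (hExponent n xs) k ≤ sumFrom1 n ⌊ n /_⌋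
ordΦ-∏-h≤ n xs k = sumFrom1-mono-≤ n λ i _ → begin
  hExponent n xs i * ordΦ k i    ≤⟨ ℕP.*-monoʳ-≤ (hExponent n xs i) (ordΦ≤1 k i) ⟩
  hExponent n xs i * 1           ≡⟨ ℕP.*-identityʳ _ ⟩
  ⌊ n / i ⌋ ∸ mult xs i          ≤⟨ ℕP.m∸n≤m ⌊ n / i ⌋ (mult xs i) ⟩
  ⌊ n / i ⌋                      ∎
  where open ℕP.≤-Reasoning

x^−1-*ₚ-1+x^ : ∀ i → x^ i −1 *ₚ onePlusXPow i ≈ x^ (i + i) −1
x^−1-*ₚ-1+x^ i = ≈-trans (difference-of-squares (xpow i)) (≈-sym (x^+−1 i i))
  where
  difference-of-squares : ∀ u → (u -ₚ oneₚ) *ₚ (oneₚ +ₚ u) ≈ u *ₚ (u -ₚ oneₚ) +ₚ (u -ₚ oneₚ)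
  difference-of-squares = solve-∀ ℤ[x]-solverRing

1+x^≈prodPow-cyclotomic : ∀ D i → 1 ≤ i → i + i ≤ D → onePlusXPow i ≈ prodPow cyclotomic D (λ k → ordΦ k i)
1+x^≈prodPow-cyclotomic D i 1≤i 2i≤D = *ₚ-cancelˡ-unitConst (unitConst-x^−1 i 1≤i) (begin
  x^ i −1 *ₚ onePlusXPow i
    ≈⟨ x^−1-*ₚ-1+x^ i ⟩
  x^ (i + i) −1
    ≈⟨ prodPow-cyclotomic D (i + i) (ℕP.≤-trans 1≤i (ℕP.m≤m+n i i) , 2i≤D) ⟨
  prodPow cyclotomic D [_∣ i + i ]
    ≈⟨ prodPow-split cyclotomic D (λ k _ → [∣]-double k i) ⟩
  prodPow cyclotomic D [_∣ i ] *ₚ prodPow cyclotomic D (λ k → ordΦ k i)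
    ≈⟨ *ₚ-congˡ (prodPow-cyclotomic D i (1≤i , ℕP.≤-trans (ℕP.m≤m+n i i) 2i≤D)) _ ⟩
  x^ i −1 *ₚ prodPow cyclotomic D (λ k → ordΦ k i) ∎)
  where open ℤ[x]-Reasoning

prodOnePlus≈prodPow-cyclotomic : ∀ n c → prodOnePlus n c ≈ prodPow cyclotomic (n + n) (ordΦ-∏ n c)
prodOnePlus≈prodPow-cyclotomic n c = begin
  prodFrom1 n (λ i → onePlusXPow i ^ₚ c i)
    ≈⟨ prodFrom1-cong n (λ i r → ^ₚ-cong (factor i r) (c i)) ⟩
  prodFrom1 n (λ i → prodPow cyclotomic (n + n) (λ k → ordΦ k i) ^ₚ c i)
    ≈⟨ prodFrom1-cong n (λ i _ → prodPow-^ₚ cyclotomic (n + n) _ (c i)) ⟩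
  prodFrom1 n (λ i → prodPow cyclotomic (n + n) (λ k → c i * ordΦ k i))
    ≈⟨ prodFrom1-prodPow cyclotomic (n + n) n (λ i k → c i * ordΦ k i) ⟩
  prodPow cyclotomic (n + n) (ordΦ-∏ n c) ∎
  where
  open ℤ[x]-Reasoning
  factor : ∀ i → i ∈[1, n ] → onePlusXPow i ≈ prodPow cyclotomic (n + n) (λ k → ordΦ k i)
  factor i (1≤i , i≤n) = 1+x^≈prodPow-cyclotomic (n + n) i 1≤i (ℕP.+-mono-≤ i≤n i≤n)

hPoly≈prodOnePlus : ∀ n xs → hPoly n xs ≈ prodOnePlus n (hExponent n xs)
hPoly≈prodOnePlus n xs = prodFrom1-cong n λ { (suc i) _ → ≈-refl }

unitConst-prodPow-cyclotomic : ∀ D E → UnitConst (prodPow cyclotomic D E)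
unitConst-prodPow-cyclotomic D E = unitConst-prodPow cyclotomic D E λ k r → unitConst-cyclotomic k (proj₁ r)

G : ℕ → Poly
G n = prodOnePlus n (gcdExponent n)

G∣hPoly : ∀ n xs → IsPartition n xs → G n ∣ₓ hPoly n xs
G∣hPoly n xs p = ∣ₓ-respʳ-≈
  (∣ₓ-respˡ-≈ (≈-sym (prodOnePlus≈prodPow-cyclotomic n (gcdExponent n))) (prodPow-∣ₓ cyclotomic (n + n) (ordΦ-∏-gcd≤h n xs p)))
  (≈-sym (≈-trans (hPoly≈prodOnePlus n xs) (prodOnePlus≈prodPow-cyclotomic n (hExponent n xs))))

except : ℕ → ℕ → ℕ → ℕ
except k K j = (1 ∸ δ k j) * K

except-self : ∀ k K → except k K k ≡ 0
except-self k K = cong (λ z → (1 ∸ z) * K) (δ-refl k)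

except-other : ∀ k K j → j ≢ k → except k K j ≡ K
except-other k K j j≢k = trans (cong (λ z → (1 ∸ z) * K) (δ-≢ k j j≢k)) (ℕP.+-identityʳ K)

-- Φ_(m+2)^K is coprime to ∏_{j ≤ m+1} Φ_j^K, and each cofactor with k ≤ m + 1 contains Φ_(m+2)^K.
∣ℚ-of-cofactors : ∀ Φ m → PairwiseCoprimeℚ Φ (suc m) → ∀ {q} K H →
  (∀ k → k ∈[1, suc m ] → q ∣ℚ H *ₚ prodPow Φ (suc m) (except k K)) → q ∣ℚ H
∣ℚ-of-cofactors Φ zero cop K H hyp = ∣ℚ-respʳ-≈ (hyp 1 (∈[1,]-top 0)) (begin
  H *ₚ (oneₚ *ₚ Φ 1 ^ₚ except 1 K 1)   ≈⟨ *ₚ-congʳ H (*ₚ-congʳ oneₚ (≡⇒≈ (cong (Φ 1 ^ₚ_) (except-self 1 K)))) ⟩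
  H *ₚ (oneₚ *ₚ oneₚ)                  ≈⟨ *ₚ-congʳ H (*ₚ-identityˡ oneₚ) ⟩
  H *ₚ oneₚ                            ≈⟨ *ₚ-identityʳ H ⟩
  H                                    ∎)
  where open ℤ[x]-Reasoning
∣ℚ-of-cofactors Φ (suc m) cop {q} K H hyp = ∣ℚ-coprimeℚ-cofactors q∣HP q∣HT P⊥T
  where
  d = suc (suc m)
  P = Φ d ^ₚ K
  T = prodPow Φ (suc m) (except d K)
  q∣HP : q ∣ℚ H *ₚ P
  q∣HP = ∣ℚ-of-cofactors Φ m (λ k j r s → cop k j (∈[1,]-suc r) (∈[1,]-suc s)) K (H *ₚ P) λ k r →
    ∣ℚ-respʳ-≈ (hyp k (∈[1,]-suc r)) (begin
      H *ₚ (prodPow Φ (suc m) (except k K) *ₚ Φ d ^ₚ except k K d)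
        ≈⟨ *ₚ-congʳ H (*ₚ-congʳ (prodPow Φ (suc m) (except k K))
                                (≡⇒≈ (cong (Φ d ^ₚ_) (except-other k K d (≢-sym (∈[1,]-below-top r)))))) ⟩
      H *ₚ (prodPow Φ (suc m) (except k K) *ₚ P)
        ≈⟨ swap H _ P ⟩
      (H *ₚ P) *ₚ prodPow Φ (suc m) (except k K) ∎)
    where
    open ℤ[x]-Reasoning
    swap : ∀ h w p → h *ₚ (w *ₚ p) ≈ (h *ₚ p) *ₚ w
    swap = solve-∀ ℤ[x]-solverRing
  q∣HT : q ∣ℚ H *ₚ T
  q∣HT = ∣ℚ-respʳ-≈ (hyp d (∈[1,]-top (suc m)))
    (*ₚ-congʳ H (≈-trans (*ₚ-congʳ T (≡⇒≈ (cong (Φ d ^ₚ_) (except-self d K)))) (*ₚ-identityʳ T)))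
  P⊥T : Coprimeℚ P T
  P⊥T = coprimeℚ-prodFrom1ʳ (suc m) λ j r →
    subst (Coprimeℚ P) (cong (Φ j ^ₚ_) (sym (except-other d K j (∈[1,]-below-top r))))
      (coprimeℚ-^ (cop d j (∈[1,]-top (suc m)) (∈[1,]-suc r) (≢-sym (∈[1,]-below-top r))) K)

unitConst-hPoly : ∀ n xs → UnitConst (hPoly n xs)
unitConst-hPoly n xs =
  unitConst-≈ (≈-sym (≈-trans (hPoly≈prodOnePlus n xs) (prodOnePlus≈prodPow-cyclotomic n (hExponent n xs))))
  (unitConst-prodPow-cyclotomic (n + n) (ordΦ-∏ n (hExponent n xs)))

-- For each Φ_k some h_λ attains the minimal exponent, so q divides G times the cofactor of Φ_k.
∣ₓ-all-hPoly⇒∣ₓG : ∀ n → 1 ≤ n → ∀ q → (∀ xs → IsPartition n xs → q ∣ₓ hPoly n xs) → q ∣ₓ G n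
∣ₓ-all-hPoly⇒∣ₓG n@(suc n′) _ q q∣h =
  ∣ₓ-respʳ-≈ (∣ℚ⇒∣ₓ unitConst-q q∣ℚΠ) (≈-sym (prodOnePlus≈prodPow-cyclotomic n (gcdExponent n)))
  where
  EG = ordΦ-∏ n (gcdExponent n)
  K = sumFrom1 n ⌊ n /_⌋
  Π : (ℕ → ℕ) → Poly
  Π = prodPow cyclotomic (n + n)
  unitConst-q : UnitConst q
  unitConst-q = unitConst-*ₚ⁻ˡ (equation (q∣h (blockPartition n 0) (blockPartition-isPartition n 0))) (unitConst-hPoly n _)
  q∣cofactor : ∀ k → k ∈[1, n + n ] → q ∣ₓ Π EG *ₚ Π (except k K)
  q∣cofactor k r with ordΦ-∏-h-attains-gcd n k r
  ... | xs , p , Eh≤EG =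
    ∣ₓ-trans (q∣h xs p) (∣ₓ-respˡ-≈ (≈-sym h≈) (*-∣ₓ-* (∣ₓ-refl (Π EG)) (prodPow-∣ₓ cyclotomic (n + n) λ j _ → excess≤ j)))
    where
    Eh = ordΦ-∏ n (hExponent n xs)
    h≈ : hPoly n xs ≈ Π EG *ₚ Π (λ j → Eh j ∸ EG j)
    h≈ = ≈-trans (≈-trans (hPoly≈prodOnePlus n xs) (prodOnePlus≈prodPow-cyclotomic n (hExponent n xs)))
                 (prodPow-split cyclotomic (n + n) (ordΦ-∏-gcd≤h n xs p))
    excess≤ : ∀ j → Eh j ∸ EG j ≤ except k K j
    excess≤ j = by-cases (j ℕ.≟ k)
      where
      by-cases : Dec (j ≡ k) → Eh j ∸ EG j ≤ except k K j
      by-cases (yes refl) = ℕP.≤-reflexive (trans (ℕP.m≤n⇒m∸n≡0 Eh≤EG) (sym (except-self j K)))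
      by-cases (no  j≢k)  = begin
        Eh j ∸ EG j              ≤⟨ ℕP.m∸n≤m (Eh j) (EG j) ⟩
        Eh j                     ≤⟨ ordΦ-∏-h≤ n xs j ⟩
        K                        ≡⟨ except-other k K j j≢k ⟨
        except k K j             ∎
        where open ℕP.≤-Reasoning
  q∣ℚΠ : q ∣ℚ Π EG
  q∣ℚΠ = ∣ℚ-of-cofactors cyclotomic (n′ + n) (λ k j r s → coprimeℚ-cyclotomic k j (proj₁ r) (proj₁ s)) K (Π EG)
    λ k r → ∣ₓ⇒∣ℚ (q∣cofactor k r)

-- Monicity, evaluation at 1 and the exponent sum

MonicAt : Poly → ℕ → Set
MonicAt p d = coeff p d ≡ + 1 × (∀ k → d < k → coeff p k ≡ + 0)

monicAt-≈ : ∀ {p q d} → p ≈ q → MonicAt p d → MonicAt q d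
monicAt-≈ e (lead , above) = trans (sym (at e _)) lead , λ k d<k → trans (sym (at e k)) (above k d<k)

monicAt-*ₚ : ∀ p q d e → MonicAt p d → MonicAt q e → MonicAt (p *ₚ q) (d + e)
monicAt-*ₚ []      q d       e (() , _)
monicAt-*ₚ (a ∷ p) q zero    e (a≡1 , above) q-monic = monicAt-≈ q≈[a∷p]q q-monic
  where
  q≈[a∷p]q : q ≈ (a ∷ p) *ₚ q
  q≈[a∷p]q = ≈-sym (≈-trans (+ₚ-cong (≈-trans (scale-congˡ q a≡1) (scale-identity q))
                                     (≈-trans (∷-cong refl (*ₚ-zeroˡ (mk≈ {p} λ k → above (suc k) (s≤s z≤n)) q)) shift-[]))
                            (+ₚ-identityʳ q))
monicAt-*ₚ (a ∷ p) q (suc d) e (lead , above) (q-lead , q-above) = lead′ , above′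
  where
  IH = monicAt-*ₚ p q d e (lead , λ k d<k → above (suc k) (s≤s d<k)) (q-lead , q-above)
  a*q-above : ∀ k → e < k → a *ℤ coeff q k ≡ + 0
  a*q-above k e<k = trans (cong (a *ℤ_) (q-above k e<k)) (ℤP.*-zeroʳ a)
  coeff-suc : ∀ k → coeff ((a ∷ p) *ₚ q) (suc k) ≡ a *ℤ coeff q (suc k) +ℤ coeff (p *ₚ q) k
  coeff-suc k = trans (coeff-+ₚ (scale a q) (shift (p *ₚ q)) (suc k)) (cong (_+ℤ coeff (p *ₚ q) k) (coeff-scale a q (suc k)))
  lead′ : coeff ((a ∷ p) *ₚ q) (suc (d + e)) ≡ + 1
  lead′ = trans (coeff-suc (d + e)) (cong₂ _+ℤ_ (a*q-above (suc (d + e)) (s≤s (ℕP.m≤n+m e d))) (proj₁ IH))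
  above′ : ∀ k → suc (d + e) < k → coeff ((a ∷ p) *ₚ q) k ≡ + 0
  above′ (suc k) (s≤s d+e<k) = trans (coeff-suc k)
    (cong₂ _+ℤ_ (a*q-above (suc k) (s≤s (ℕP.≤-trans (ℕP.m≤n+m e d) (ℕP.<⇒≤ d+e<k)))) (proj₂ IH k d+e<k))

monicAt-oneₚ : MonicAt oneₚ 0
monicAt-oneₚ = refl , λ { (suc k) _ → refl }

monicAt-^ₚ : ∀ {p d} → MonicAt p d → ∀ m → MonicAt (p ^ₚ m) (m * d)
monicAt-^ₚ h zero          = monicAt-oneₚ
monicAt-^ₚ {p} {d} h (suc m) = monicAt-*ₚ p (p ^ₚ m) d (m * d) h (monicAt-^ₚ h m)

monicAt-1+x^ : ∀ i → MonicAt (onePlusXPow (suc i)) (suc i)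
monicAt-1+x^ i = trans (coeff-+ₚ oneₚ (xpow (suc i)) (suc i)) (cong (+ 0 +ℤ_) (coeff-xpow-same i))
               , λ { (suc k) i<k → trans (coeff-+ₚ oneₚ (xpow (suc i)) (suc k))
                                        (cong (+ 0 +ℤ_) (coeff-xpow-other i k (ℕP.≤-pred i<k))) }
  where
  coeff-xpow-same : ∀ i → coeff (xpow i) i ≡ + 1
  coeff-xpow-same zero    = refl
  coeff-xpow-same (suc i) = coeff-xpow-same i
  coeff-xpow-other : ∀ i k → i < k → coeff (xpow i) k ≡ + 0
  coeff-xpow-other zero    (suc k) _         = refl
  coeff-xpow-other (suc i) (suc k) (s≤s i<k) = coeff-xpow-other i k i<k

monic-prodOnePlus : ∀ n c → Monic (prodOnePlus n c)
monic-prodOnePlus zero    c = 0 , monicAt-oneₚ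
monic-prodOnePlus (suc n) c with monic-prodOnePlus n c
... | d , monic = d + c (suc n) * suc n
                , monicAt-*ₚ (prodOnePlus n c) _ d (c (suc n) * suc n) monic (monicAt-^ₚ (monicAt-1+x^ n) (c (suc n)))

eval-[] : ∀ {p} x → p ≈ [] → eval p x ≡ + 0
eval-[] {[]}    x e = refl
eval-[] {a ∷ p} x e = begin
  a +ℤ x *ℤ eval p x    ≡⟨ cong₂ _+ℤ_ (at e 0) (cong (x *ℤ_) (eval-[] x (mk≈ {p} λ k → at e (suc k)))) ⟩
  + 0 +ℤ x *ℤ + 0       ≡⟨ cong (+ 0 +ℤ_) (ℤP.*-zeroʳ x) ⟩
  + 0                   ∎
  where open ≡-Reasoning

eval-cong : ∀ {p q} x → p ≈ q → eval p x ≡ eval q x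
eval-cong {[]}    {q}     x e = sym (eval-[] x (≈-sym e))
eval-cong {a ∷ p} {[]}    x e = eval-[] x e
eval-cong {a ∷ p} {b ∷ q} x e = cong₂ _+ℤ_ (at e 0) (cong (x *ℤ_) (eval-cong x (∷-tail e)))

eval-+ₚ : ∀ p q x → eval (p +ₚ q) x ≡ eval p x +ℤ eval q x
eval-+ₚ []      q       x = sym (ℤP.+-identityˡ _)
eval-+ₚ (a ∷ p) []      x = sym (ℤP.+-identityʳ _)
eval-+ₚ (a ∷ p) (b ∷ q) x = begin
  (a +ℤ b) +ℤ x *ℤ eval (p +ₚ q) x                 ≡⟨ cong (λ z → (a +ℤ b) +ℤ x *ℤ z) (eval-+ₚ p q x) ⟩
  (a +ℤ b) +ℤ x *ℤ (eval p x +ℤ eval q x)          ≡⟨ regroup a b x (eval p x) (eval q x) ⟩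
  (a +ℤ x *ℤ eval p x) +ℤ (b +ℤ x *ℤ eval q x)     ∎
  where
  open ≡-Reasoning
  regroup : ∀ a b x u v → (a +ℤ b) +ℤ x *ℤ (u +ℤ v) ≡ (a +ℤ x *ℤ u) +ℤ (b +ℤ x *ℤ v)
  regroup = ℤ-Solver.solve-∀

eval-scale : ∀ a p x → eval (scale a p) x ≡ a *ℤ eval p x
eval-scale a []      x = sym (ℤP.*-zeroʳ a)
eval-scale a (b ∷ p) x = trans (cong (λ z → a *ℤ b +ℤ x *ℤ z) (eval-scale a p x)) (regroup a b x (eval p x))
  where
  regroup : ∀ a b x u → a *ℤ b +ℤ x *ℤ (a *ℤ u) ≡ a *ℤ (b +ℤ x *ℤ u)
  regroup = ℤ-Solver.solve-∀

eval-*ₚ : ∀ p q x → eval (p *ₚ q) x ≡ eval p x *ℤ eval q x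
eval-*ₚ []      q x = refl
eval-*ₚ (a ∷ p) q x = begin
  eval (scale a q +ₚ shift (p *ₚ q)) x                 ≡⟨ eval-+ₚ (scale a q) (shift (p *ₚ q)) x ⟩
  eval (scale a q) x +ℤ (+ 0 +ℤ x *ℤ eval (p *ₚ q) x)  ≡⟨ cong₂ (λ u v → u +ℤ (+ 0 +ℤ x *ℤ v)) (eval-scale a q x) (eval-*ₚ p q x) ⟩
  a *ℤ eval q x +ℤ (+ 0 +ℤ x *ℤ (eval p x *ℤ eval q x)) ≡⟨ regroup a x (eval p x) (eval q x) ⟩
  (a +ℤ x *ℤ eval p x) *ℤ eval q x                      ∎
  where
  open ≡-Reasoning
  regroup : ∀ a x u v → a *ℤ v +ℤ (+ 0 +ℤ x *ℤ (u *ℤ v)) ≡ (a +ℤ x *ℤ u) *ℤ v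
  regroup = ℤ-Solver.solve-∀

eval-1+x^-at-1 : ∀ i → eval (onePlusXPow i) (+ 1) ≡ + 2
eval-1+x^-at-1 i = trans (eval-+ₚ oneₚ (xpow i) (+ 1)) (cong (+ 1 +ℤ_) (eval-xpow i))
  where
  eval-xpow : ∀ i → eval (xpow i) (+ 1) ≡ + 1
  eval-xpow zero    = refl
  eval-xpow (suc i) = cong (λ z → + 0 +ℤ + 1 *ℤ z) (eval-xpow i)

eval-prodOnePlus-at-1 : ∀ n c → eval (prodOnePlus n c) (+ 1) ≡ + (2 ^ sumFrom1 n c)
eval-prodOnePlus-at-1 zero    c = refl
eval-prodOnePlus-at-1 (suc n) c = begin
  eval (prodOnePlus n c *ₚ onePlusXPow (suc n) ^ₚ c (suc n)) (+ 1)
    ≡⟨ eval-*ₚ (prodOnePlus n c) _ (+ 1) ⟩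
  eval (prodOnePlus n c) (+ 1) *ℤ eval (onePlusXPow (suc n) ^ₚ c (suc n)) (+ 1)
    ≡⟨ cong₂ _*ℤ_ (eval-prodOnePlus-at-1 n c) (eval-^ₚ (c (suc n))) ⟩
  + (2 ^ sumFrom1 n c) *ℤ + (2 ^ c (suc n))
    ≡⟨ ℤP.pos-* (2 ^ sumFrom1 n c) (2 ^ c (suc n)) ⟨
  + (2 ^ sumFrom1 n c * 2 ^ c (suc n))
    ≡⟨ cong +_ (ℕP.^-distribˡ-+-* 2 (sumFrom1 n c) (c (suc n))) ⟨
  + (2 ^ sumFrom1 (suc n) c) ∎
  where
  open ≡-Reasoning
  eval-^ₚ : ∀ m → eval (onePlusXPow (suc n) ^ₚ m) (+ 1) ≡ + (2 ^ m)
  eval-^ₚ zero    = refl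
  eval-^ₚ (suc m) = trans (eval-*ₚ (onePlusXPow (suc n)) (onePlusXPow (suc n) ^ₚ m) (+ 1))
    (trans (cong₂ _*ℤ_ (eval-1+x^-at-1 (suc n)) (eval-^ₚ m)) (sym (ℤP.pos-* 2 (2 ^ m))))

eval-∣ₓ : ∀ {p q} x → p ∣ₓ q → ℤ.∣ eval p x ∣ ∣ ℤ.∣ eval q x ∣
eval-∣ₓ {p} {q} x (mk∣ₓ r pr≈q) = divides ℤ.∣ eval r x ∣ (begin
  ℤ.∣ eval q x ∣                       ≡⟨ cong ℤ.∣_∣ (eval-cong x pr≈q) ⟨
  ℤ.∣ eval (p *ₚ r) x ∣                ≡⟨ cong ℤ.∣_∣ (eval-*ₚ p r x) ⟩
  ℤ.∣ eval p x *ℤ eval r x ∣           ≡⟨ ℤP.abs-* (eval p x) (eval r x) ⟩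
  ℤ.∣ eval p x ∣ * ℤ.∣ eval r x ∣      ≡⟨ ℕP.*-comm ℤ.∣ eval p x ∣ _ ⟩
  ℤ.∣ eval r x ∣ * ℤ.∣ eval p x ∣      ∎)
  where open ≡-Reasoning

2^-injective : ∀ a b → 2 ^ a ≡ 2 ^ b → a ≡ b
2^-injective a b e with ℕP.<-cmp a b
... | tri≈ _ a≡b _ = a≡b
... | tri< a<b _ _ = ⊥-elim (ℕP.<⇒≢ (ℕP.^-monoʳ-< 2 (s≤s (s≤s z≤n)) a<b) e)
... | tri> _ _ b<a = ⊥-elim (ℕP.<⇒≢ (ℕP.^-monoʳ-< 2 (s≤s (s≤s z≤n)) b<a) (sym e))

-- Associated products of the 1 + x^i have equal evaluations at 1, hence equal exponent sums.
sumFrom1-≡-if-prodOnePlus-associated : ∀ n c c′ → prodOnePlus n c ∣ₓ prodOnePlus n c′ → prodOnePlus n c′ ∣ₓ prodOnePlus n c →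
  sumFrom1 n c ≡ sumFrom1 n c′
sumFrom1-≡-if-prodOnePlus-associated n c c′ ∣′ ∣″ = 2^-injective _ _ (∣-antisym (at-1 ∣′) (at-1 ∣″))
  where
  at-1 : ∀ {c c′} → prodOnePlus n c ∣ₓ prodOnePlus n c′ → 2 ^ sumFrom1 n c ∣ 2 ^ sumFrom1 n c′
  at-1 {c} {c′} d =
    subst₂ _∣_ (cong ℤ.∣_∣ (eval-prodOnePlus-at-1 n c)) (cong ℤ.∣_∣ (eval-prodOnePlus-at-1 n c′)) (eval-∣ₓ (+ 1) d)

count-divisors-upTo : ∀ m i → length (filter (_∣? m) (map suc (upTo i))) ≡ sumFrom1 i [_∣ m ]
count-divisors-upTo m zero    = refl
count-divisors-upTo m (suc i) = begin
  length (filter (_∣? m) (map suc (upTo (suc i))))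
    ≡⟨ cong (λ l → length (filter (_∣? m) (map suc l))) (ListP.upTo-∷ʳ i) ⟨
  length (filter (_∣? m) (map suc (upTo i ++ i ∷ [])))
    ≡⟨ cong (λ l → length (filter (_∣? m) l)) (ListP.map-++ suc (upTo i) (i ∷ [])) ⟩
  length (filter (_∣? m) (map suc (upTo i) ++ suc i ∷ []))
    ≡⟨ cong length (ListP.filter-++ (_∣? m) (map suc (upTo i)) (suc i ∷ [])) ⟩
  length (filter (_∣? m) (map suc (upTo i)) ++ filter (_∣? m) (suc i ∷ []))
    ≡⟨ ListP.length-++ (filter (_∣? m) (map suc (upTo i))) ⟩
  length (filter (_∣? m) (map suc (upTo i))) + length (filter (_∣? m) (suc i ∷ []))
    ≡⟨ cong₂ _+_ (count-divisors-upTo m i) (last (suc i)) ⟩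
  sumFrom1 i [_∣ m ] + [ suc i ∣ m ] ∎
  where
  open ≡-Reasoning
  last : ∀ d → length (filter (_∣? m) (d ∷ [])) ≡ [ d ∣ m ]
  last d with d ∣? m
  ... | yes _ = refl
  ... | no  _ = refl

-- From n to n + 1 the left side gains σ₀(n + 1) and each ⌊n/d⌋ on the right gains [d ∣ n + 1].
sumFrom1-σ₀ : ∀ n → sumFrom1 n σ₀ ≡ sumFrom1 n ⌊ n /_⌋
sumFrom1-σ₀ zero    = refl
sumFrom1-σ₀ (suc n) = begin
  sumFrom1 n σ₀ + σ₀ (suc n)
    ≡⟨ cong₂ _+_ (sumFrom1-σ₀ n) (count-divisors-upTo (suc n) (suc n)) ⟩
  sumFrom1 n ⌊ n /_⌋ + sumFrom1 (suc n) [_∣ suc n ]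
    ≡⟨ cong (_+ sumFrom1 (suc n) [_∣ suc n ]) extend ⟩
  sumFrom1 (suc n) ⌊ n /_⌋ + sumFrom1 (suc n) [_∣ suc n ]
    ≡⟨ sumFrom1-distrib-+ (suc n) ⌊ n /_⌋ [_∣ suc n ] ⟨
  sumFrom1 (suc n) (λ d → ⌊ n / d ⌋ + [ d ∣ suc n ])
    ≡⟨ sumFrom1-cong (suc n) (λ { (suc e) _ → sym (/-suc e n) }) ⟩
  sumFrom1 (suc n) ⌊ suc n /_⌋ ∎
  where
  open ≡-Reasoning
  extend : sumFrom1 n ⌊ n /_⌋ ≡ sumFrom1 (suc n) ⌊ n /_⌋
  extend = sym (trans (cong (_+_ (sumFrom1 n ⌊ n /_⌋)) (m<n⇒m/n≡0 {n} {suc n} ℕP.≤-refl)) (ℕP.+-identityʳ _))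

sumFrom1-gcdExponent : ∀ n → sumFrom1 n (gcdExponent n) + val₂ (n !) + n ≡ sumFrom1 n σ₀
sumFrom1-gcdExponent n = begin
  sumFrom1 n (gcdExponent n) + val₂ (n !) + n
    ≡⟨ ℕP.+-assoc (sumFrom1 n (gcdExponent n)) (val₂ (n !)) n ⟩
  sumFrom1 n (gcdExponent n) + (val₂ (n !) + n)
    ≡⟨ cong (_+_ (sumFrom1 n (gcdExponent n))) (trans (ℕP.+-comm (val₂ (n !)) n) (sym (sumFrom1-doublings n))) ⟩
  sumFrom1 n (gcdExponent n) + sumFrom1 n (doublings n)
    ≡⟨ sumFrom1-distrib-+ n (gcdExponent n) (doublings n) ⟨
  sumFrom1 n (λ i → gcdExponent n i + doublings n i)
    ≡⟨ sumFrom1-cong n (λ i r → ℕP.m∸n+n≡m (doublings≤⌊/⌋ n i (proj₁ r))) ⟩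
  sumFrom1 n ⌊ n /_⌋
    ≡⟨ sumFrom1-σ₀ n ⟨
  sumFrom1 n σ₀ ∎
  where open ≡-Reasoning

G-isMonicGcdH : ∀ n → 1 ≤ n → IsMonicGcdH n (G n)
G-isMonicGcdH n 1≤n = monic-prodOnePlus n (gcdExponent n)
                    , (λ xs p → ∣ₓ⇒∣ₚ (G∣hPoly n xs p))
                    , (λ q q∣h → ∣ₓ⇒∣ₚ (∣ₓ-all-hPoly⇒∣ₓG n 1≤n q λ xs p → ∣ₚ⇒∣ₓ (q∣h xs p)))

-- Any monic gcd is associated with G n, so its exponents have the same sum.
sumFrom1-exponents-of-monicGcd : ∀ n → 1 ≤ n → ∀ g → IsMonicGcdH n g → ∀ c → g ≈ prodOnePlus n c →
  sumFrom1 n (gcdExponent n) ≡ sumFrom1 n c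
sumFrom1-exponents-of-monicGcd n 1≤n g (_ , g∣h , g-greatest) c g≈ =
  sumFrom1-≡-if-prodOnePlus-associated n (gcdExponent n) c G∣g g∣G
  where
  G∣g : G n ∣ₓ prodOnePlus n c
  G∣g = ∣ₓ-respʳ-≈ (∣ₚ⇒∣ₓ (g-greatest (G n) λ xs p → ∣ₓ⇒∣ₚ (G∣hPoly n xs p))) g≈
  g∣G : prodOnePlus n c ∣ₓ G n
  g∣G = ∣ₓ-respˡ-≈ g≈ (∣ₚ⇒∣ₓ (proj₂ (proj₂ (G-isMonicGcdH n 1≤n)) g g∣h))

corollary3p7 : (n : ℕ) → 1 ≤ n →
    (∃ λ c → IsMonicGcdH n (prodOnePlus n c)) ×
    (∀ g → IsMonicGcdH n g → (c : ℕ → ℕ) → g ≈ₚ prodOnePlus n c →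
      (eval g (+ 1) ≡ + (2 ^ sumFrom1 n c)) ×
      (sumFrom1 n c + val₂ (n !) + n ≡ sumFrom1 n σ₀))
corollary3p7 n 1≤n = (gcdExponent n , G-isMonicGcdH n 1≤n) , λ g g-gcd c g≈ₚ →
  let g≈ = mk≈ {g} {prodOnePlus n c} g≈ₚ in
    trans (eval-cong (+ 1) g≈) (eval-prodOnePlus-at-1 n c)
  , subst (λ s → s + val₂ (n !) + n ≡ sumFrom1 n σ₀)
          (sumFrom1-exponents-of-monicGcd n 1≤n g g-gcd c g≈)
          (sumFrom1-gcdExponent n)
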